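{- Let $w$ be a binary word with $|w|>7$ and $l(w)=3$. Then all elements of $\mathtt{BR}(w)$ are rich if and only if $w$ is of one of the following forms: $a^2b^4a^2$, $ab^{m_2}a$, $a^{m_1}ba^{m_3}$, $a^{m_1}b^2a^{m_3}$ with $m_i\ge1$; or $ab^{n_2}a^{n_3}$, $a^{n_1}b^{n_2}a$ with $n_2\in\{3,4\}$ and $n_1,n_3\ge 3$.
   Context: A binary word is a word over a two-letter alphabet $\{a,b\}$ in which both letters occur; $a$ and $b$ denote the two letters in either order (the statement is understood up to exchanging them). For a non-empty word, its run-length encoding is $c_1^{n_1}\cdots c_k^{n_k}$ with $c_i\ne c_{i+1}$, $n_i\ge1$; $l(w)=k$. $\mathtt{BR}(w)=\{B_t\cdots B_1 : w=B_1\cdots B_t,\ t\ge1,\ B_i \text{ non-empty}\}$. A word $w$ is rich if it has exactly $|w|$ distinct non-empty palindromic factors. -}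

module Defs where

open import Data.Bool using (Bool; true; false)
open import Data.Bool.Properties using () renaming (_≟_ to _≟ᵇ_)
open import Data.Nat using (ℕ; zero; suc; _≤_; _<_)
open import Data.List using (List; []; _∷_; _++_; length; reverse; concat; replicate; [_])
open import Data.List.Relation.Unary.All using (All)
open import Data.List.Relation.Unary.Unique.Propositional using (Unique)
open import Data.List.Membership.Propositional using (_∈_)
open import Data.Product using (Σ; ∃; ∃-syntax; _×_; _,_)
open import Data.Sum using (_⊎_)
open import Relation.Binary.PropositionalEquality using (_≡_; _≢_)
open import Relation.Nullary using (yes; no)
open import Function using (_⇔_)

Letter : Set
Letter = Bool

Word : Set
Word = List Letter

Binary : Word → Set
Binary w = (true ∈ w) × (false ∈ w)

rle : Word → List (Letter × ℕ)
rle [] = []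
rle (x ∷ w) with rle w
... | [] = (x , 1) ∷ []
... | (c , n) ∷ r with x ≟ᵇ c
...   | yes _ = (c , suc n) ∷ r
...   | no _  = (x , 1) ∷ (c , n) ∷ r

l : Word → ℕ
l w = length (rle w)

NonEmpty : Word → Set
NonEmpty u = 0 < length u

Factor : Word → Word → Set
Factor u w = ∃[ p ] ∃[ s ] (p ++ u ++ s ≡ w)

Palindrome : Word → Set
Palindrome u = reverse u ≡ u

PalFactor : Word → Word → Set
PalFactor w u = NonEmpty u × Palindrome u × Factor u w

Rich : Word → Set
Rich w = ∃[ L ] (Unique L × (∀ u → (u ∈ L) ⇔ PalFactor w u) × length L ≡ length w)

InBR : Word → Word → Set
InBR w v = ∃[ Bs ] (0 < length Bs × All NonEmpty Bs × concat Bs ≡ w × v ≡ concat (reverse Bs))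

_^_ : Letter → ℕ → Word
x ^ n = replicate n x

-- the forms of the proposition, for letters x ≠ y (covering both assignments of a, b)
Forms : Word → Set
Forms w = ∃[ x ] ∃[ y ] (x ≢ y ×
  ( (w ≡ (x ^ 2) ++ (y ^ 4) ++ (x ^ 2))
  ⊎ (∃[ m₂ ] (1 ≤ m₂ × w ≡ [ x ] ++ (y ^ m₂) ++ [ x ]))
  ⊎ (∃[ m₁ ] ∃[ m₃ ] (1 ≤ m₁ × 1 ≤ m₃ × w ≡ (x ^ m₁) ++ [ y ] ++ (x ^ m₃)))
  ⊎ (∃[ m₁ ] ∃[ m₃ ] (1 ≤ m₁ × 1 ≤ m₃ × w ≡ (x ^ m₁) ++ (y ^ 2) ++ (x ^ m₃)))
  ⊎ (∃[ n₂ ] ∃[ n₃ ] ((n₂ ≡ 3 ⊎ n₂ ≡ 4) × 3 ≤ n₃ × w ≡ [ x ] ++ (y ^ n₂) ++ (x ^ n₃)))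
  ⊎ (∃[ n₁ ] ∃[ n₂ ] ((n₂ ≡ 3 ⊎ n₂ ≡ 4) × 3 ≤ n₁ × w ≡ (x ^ n₁) ++ (y ^ n₂) ++ [ x ]))))

-- Every word w has at most |w| distinct non-empty palindromic factors, since adding a letter at
-- either end creates at most one new one (its longest palindromic prefix or suffix); so w is rich
-- exactly when it can be grown letter by letter from the empty word, each step creating a
-- palindrome that did not occur before.
--
-- For the forms a b^m a, a^m b a^k and a^m b² a^k every element of BR(w) contains
-- one letter at most twice, and all such words are rich.  The elements of BR(a b^n a^m), n = 3, 4,
-- are a^e b^p a^c b^q a b^r or a^(e+1) b^n a^c; each is a factor of a word in one of seven
-- two-parameter families, which are grown letter by letter, the new palindrome of every step being
-- checked once for all parameter values by a symbolic test on run lengths.  For a²b⁴a², BR(w) is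
-- enumerated and checked.  Richness passes to factors and to reversals.
--
-- Necessity.  Every other three-run word of length at least 8 has an element of BR(w) containing
-- a a b a b b a a or b b a a b a b b, and neither of these is rich.

module Submission where

open import Defs
open import Data.Bool using (Bool; true; false; T; _∧_; _∨_)
open import Data.Bool.Properties using (T-∧; T-∨) renaming (_≟_ to _≟ᵇ_)
open import Data.Maybe using (Maybe; just; nothing)
open import Data.Nat using (ℕ; zero; suc; _+_; _*_; _∸_; _≤_; _<_; z≤n; s≤s; _≤?_; _≟_; _≤ᵇ_; _≡ᵇ_)
open import Data.Nat.Properties
open import Data.List using (List; []; _∷_; _++_; _∷ʳ_; length; reverse; concat; [_]; map; filter; deduplicate)
open import Data.List.Properties
open import Data.List.Membership.Propositional using (_∈_; find; lose)
open import Data.List.Membership.Propositional.Properties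
open import Data.List.Relation.Unary.Any using (here; there; any?)
import Data.List.Relation.Unary.Any.Properties as Any
open import Data.List.Relation.Unary.All as All using (All; []; _∷_; all?)
import Data.List.Relation.Unary.All.Properties as All
open import Data.List.Relation.Unary.AllPairs using (_∷_)
open import Data.List.Relation.Unary.Unique.Propositional using (Unique)
open import Data.List.Relation.Unary.Unique.DecPropositional.Properties using (deduplicate-!)
open import Data.Product using (∃-syntax; _×_; _,_; proj₁; proj₂)
open import Data.Sum using (_⊎_; inj₁; inj₂)
open import Data.Unit using (⊤; tt)
open import Data.Empty using (⊥; ⊥-elim)
open import Relation.Nullary using (Dec; yes; no; ¬_; ¬?)
open import Relation.Nullary.Decidable using (_×-dec_; toWitness)
open import Relation.Binary.PropositionalEquality hiding ([_])
open import Function using (_⇔_; mk⇔; Equivalence; _∘′_)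

-- Lists and runs of letters

module _ {A : Set} where

  ++-split : ∀ (a b c d : List A) → a ++ b ≡ c ++ d →
    ∃[ m ] (c ≡ a ++ m × b ≡ m ++ d) ⊎ ∃[ e ] ∃[ m ] (a ≡ c ++ e ∷ m × d ≡ e ∷ m ++ b)
  ++-split []      b c       d eq = inj₁ (c , refl , eq)
  ++-split (u ∷ a) b []      d eq = inj₂ (u , a , refl , sym eq)
  ++-split (u ∷ a) b (v ∷ c) d eq with ∷-injective eq
  ... | refl , eq′ with ++-split a b c d eq′
  ... | inj₁ (m , p , q)     = inj₁ (m , cong (u ∷_) p , q)
  ... | inj₂ (e , m , p , q) = inj₂ (e , m , cong (u ∷_) p , q)

  ++-assoc₄ : ∀ (a b c d e : List A) → (a ++ b ++ c ++ d) ++ e ≡ a ++ b ++ c ++ d ++ e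
  ++-assoc₄ a b c d e = trans (++-assoc a _ e) (cong (a ++_) (trans (++-assoc b _ e) (cong (b ++_) (++-assoc c d e))))

  ∈-remove : ∀ {x} (ys : List A) → x ∈ ys →
             ∃[ zs ] (suc (length zs) ≡ length ys × (∀ {z} → z ∈ ys → z ≢ x → z ∈ zs))
  ∈-remove (y ∷ ys) (here refl) = ys , refl , λ { (here refl) z≢y → ⊥-elim (z≢y refl) ; (there m) _ → m }
  ∈-remove (y ∷ ys) (there m) with ∈-remove ys m
  ... | zs , e , sub = y ∷ zs , cong suc e , λ { (here refl) _ → here refl ; (there m′) z≢x → there (sub m′ z≢x) }

  unique-⊆⇒length≤ : ∀ {xs ys : List A} → Unique xs → (∀ {z} → z ∈ xs → z ∈ ys) → length xs ≤ length ys
  unique-⊆⇒length≤ {[]}     _          _   = z≤n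
  unique-⊆⇒length≤ {x ∷ xs} {ys} (x∉ ∷ u) sub with ∈-remove ys (sub (here refl))
  ... | zs , e , rem = subst (suc (length xs) ≤_) e (s≤s (unique-⊆⇒length≤ u sub′))
    where
    sub′ : ∀ {z} → z ∈ xs → z ∈ zs
    sub′ m = rem (sub (there m)) (λ { refl → All.lookup x∉ m refl })

below-or-above : ∀ s d → ∃[ k ] (d ≡ suc (s + k)) ⊎ d ≤ s
below-or-above s       zero    = inj₂ z≤n
below-or-above zero    (suc d) = inj₁ (d , refl)
below-or-above (suc s) (suc d) with below-or-above s d
... | inj₁ (k , refl) = inj₁ (k , refl)
... | inj₂ d≤s        = inj₂ (s≤s d≤s)

by-distinct-letters : ∀ {p} {P : Letter → Letter → Set p} → P true false → P false true →
                      ∀ {x y} → x ≢ y → P x y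
by-distinct-letters t f {true}  {false} _   = t
by-distinct-letters t f {false} {true}  _   = f
by-distinct-letters t f {true}  {true}  x≢y = ⊥-elim (x≢y refl)
by-distinct-letters t f {false} {false} x≢y = ⊥-elim (x≢y refl)

x-or-y : ∀ {x y} → x ≢ y → ∀ c → c ≡ x ⊎ c ≡ y
x-or-y = by-distinct-letters {P = λ x y → ∀ c → c ≡ x ⊎ c ≡ y}
  (λ { true → inj₁ refl ; false → inj₂ refl }) (λ { false → inj₁ refl ; true → inj₂ refl })

^-+ : ∀ (c : Letter) m n → c ^ (m + n) ≡ c ^ m ++ c ^ n
^-+ c zero    n = refl
^-+ c (suc m) n = cong (c ∷_) (^-+ c m n)

^-∷ʳ : ∀ (c : Letter) n → c ^ n ++ [ c ] ≡ c ^ suc n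
^-∷ʳ c zero    = refl
^-∷ʳ c (suc n) = cong (c ∷_) (^-∷ʳ c n)

^-++-∷ : ∀ (c : Letter) n w → c ^ n ++ c ∷ w ≡ c ∷ c ^ n ++ w
^-++-∷ c zero    w = refl
^-++-∷ c (suc n) w = cong (c ∷_) (^-++-∷ c n w)

reverse-^ : ∀ (c : Letter) n → reverse (c ^ n) ≡ c ^ n
reverse-^ c zero    = refl
reverse-^ c (suc n) = begin
  reverse (c ∷ c ^ n)    ≡⟨ unfold-reverse c (c ^ n) ⟩
  reverse (c ^ n) ++ [ c ] ≡⟨ cong (_++ [ c ]) (reverse-^ c n) ⟩
  c ^ n ++ [ c ]         ≡⟨ ^-∷ʳ c n ⟩
  c ^ suc n              ∎
  where open ≡-Reasoning

reverse-x^y^x^ : ∀ (x y : Letter) i j k → reverse (x ^ i ++ y ^ j ++ x ^ k) ≡ x ^ k ++ y ^ j ++ x ^ i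
reverse-x^y^x^ x y i j k = begin
  reverse (x ^ i ++ y ^ j ++ x ^ k)                  ≡⟨ reverse-++ (x ^ i) _ ⟩
  reverse (y ^ j ++ x ^ k) ++ reverse (x ^ i)        ≡⟨ cong₂ _++_ (reverse-++ (y ^ j) (x ^ k)) (reverse-^ x i) ⟩
  (reverse (x ^ k) ++ reverse (y ^ j)) ++ x ^ i      ≡⟨ cong (_++ x ^ i) (cong₂ _++_ (reverse-^ x k) (reverse-^ y j)) ⟩
  (x ^ k ++ y ^ j) ++ x ^ i                          ≡⟨ ++-assoc (x ^ k) (y ^ j) (x ^ i) ⟩
  x ^ k ++ y ^ j ++ x ^ i                            ∎
  where open ≡-Reasoning

length-x^y^x^ : ∀ (x y : Letter) n₁ n₂ n₃ → length (x ^ n₁ ++ y ^ n₂ ++ x ^ n₃) ≡ n₁ + n₂ + n₃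
length-x^y^x^ x y n₁ n₂ n₃ = begin
  length (x ^ n₁ ++ y ^ n₂ ++ x ^ n₃)             ≡⟨ length-++ (x ^ n₁) ⟩
  length (x ^ n₁) + length (y ^ n₂ ++ x ^ n₃)     ≡⟨ cong₂ _+_ (length-replicate n₁) (length-++ (y ^ n₂)) ⟩
  n₁ + (length (y ^ n₂) + length (x ^ n₃))        ≡⟨ cong (n₁ +_) (cong₂ _+_ (length-replicate n₂) (length-replicate n₃)) ⟩
  n₁ + (n₂ + n₃)                                  ≡⟨ +-assoc n₁ n₂ n₃ ⟨
  n₁ + n₂ + n₃                                    ∎
  where open ≡-Reasoning

++≡^ : ∀ (c : Letter) B R m → B ++ R ≡ c ^ m → ∃[ j ] ∃[ j′ ] (B ≡ c ^ j × R ≡ c ^ j′ × j + j′ ≡ m)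
++≡^ c []      R m       e = 0 , m , refl , e , refl
++≡^ c (b ∷ B) R (suc m) e with ∷-injective e
... | refl , e′ with ++≡^ c B R m e′
... | j , j′ , refl , refl , refl = suc j , j′ , refl , refl , refl

++≡^++^ : ∀ (c d : Letter) B R k m → B ++ R ≡ d ^ k ++ c ^ m →
  ∃[ r ] ∃[ r′ ] (B ≡ d ^ r × R ≡ d ^ r′ ++ c ^ m × r + r′ ≡ k) ⊎
  ∃[ j ] ∃[ j′ ] (B ≡ d ^ k ++ c ^ j × R ≡ c ^ j′ × j + j′ ≡ m)
++≡^++^ c d []      R k       m e = inj₁ (0 , k , refl , e , refl)
++≡^++^ c d (b ∷ B) R zero    m e with ++≡^ c (b ∷ B) R m e
... | j , j′ , p , q , s = inj₂ (j , j′ , p , q , s)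
++≡^++^ c d (b ∷ B) R (suc k) m e with ∷-injective e
... | refl , e′ with ++≡^++^ c d B R k m e′
... | inj₁ (r , r′ , refl , q , refl) = inj₁ (suc r , r′ , refl , q , refl)
... | inj₂ (j , j′ , refl , q , s)    = inj₂ (j , j′ , refl , q , s)

occurrences : Letter → Word → ℕ
occurrences c w = length (filter (c ≟ᵇ_) w)

occurrences-++ : ∀ c u v → occurrences c (u ++ v) ≡ occurrences c u + occurrences c v
occurrences-++ c u v = trans (cong length (filter-++ (c ≟ᵇ_) u v)) (length-++ (filter (c ≟ᵇ_) u))

occurrences-^ : ∀ c n → occurrences c (c ^ n) ≡ n
occurrences-^ c zero    = refl
occurrences-^ c (suc n) = trans (cong length (filter-accept (c ≟ᵇ_) {c} {c ^ n} refl)) (cong suc (occurrences-^ c n))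

occurrences-^-≢ : ∀ {c d} → c ≢ d → ∀ n → occurrences c (d ^ n) ≡ 0
occurrences-^-≢ c≢d zero    = refl
occurrences-^-≢ {c} {d} c≢d (suc n) = trans (cong length (filter-reject (c ≟ᵇ_) {d} {d ^ n} c≢d)) (occurrences-^-≢ c≢d n)

-- Factors

_≟ʷ_ : (u v : Word) → Dec (u ≡ v)
_≟ʷ_ = ≡-dec _≟ᵇ_

factor-∷ : ∀ {u w} a → Factor u w → Factor u (a ∷ w)
factor-∷ a (p , s , e) = a ∷ p , s , cong (a ∷_) e

factor-∷⁻ : ∀ {a u w} → Factor u (a ∷ w) → Factor u w ⊎ ∃[ t ] (u ++ t ≡ a ∷ w)
factor-∷⁻ ([]    , s , e) = inj₂ (s , e)
factor-∷⁻ (b ∷ p , s , e) = inj₁ (p , s , ∷-injectiveʳ e)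

factor-reverse : ∀ {u w} → Factor u w → Factor (reverse u) (reverse w)
factor-reverse {u} {w} (p , s , e) = reverse s , reverse p , (begin
  reverse s ++ reverse u ++ reverse p  ≡⟨ cong (reverse s ++_) (reverse-++ p u) ⟨
  reverse s ++ reverse (p ++ u)        ≡⟨ reverse-++ (p ++ u) s ⟨
  reverse ((p ++ u) ++ s)              ≡⟨ cong reverse (++-assoc p u s) ⟩
  reverse (p ++ u ++ s)                ≡⟨ cong reverse e ⟩
  reverse w                            ∎)
  where open ≡-Reasoning

factor-reverse⁻ : ∀ {u w} → Factor (reverse u) (reverse w) → Factor u w
factor-reverse⁻ {u} {w} f =
  subst₂ Factor (reverse-involutive u) (reverse-involutive w) (factor-reverse f)

prefixes : Word → List Word
prefixes []      = [ [] ]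
prefixes (a ∷ w) = [] ∷ map (a ∷_) (prefixes w)

factors : Word → List Word
factors []      = [ [] ]
factors (a ∷ w) = prefixes (a ∷ w) ++ factors w

∈-prefixes⁻ : ∀ w {u} → u ∈ prefixes w → ∃[ s ] (u ++ s ≡ w)
∈-prefixes⁻ []      (here refl) = [] , refl
∈-prefixes⁻ (a ∷ w) (here refl) = a ∷ w , refl
∈-prefixes⁻ (a ∷ w) (there m) with ∈-map⁻ (a ∷_) m
... | v , m′ , refl with ∈-prefixes⁻ w m′
... | s , e = s , cong (a ∷_) e

∈-prefixes⁺ : ∀ w u s → u ++ s ≡ w → u ∈ prefixes w
∈-prefixes⁺ []      []      s e = here refl
∈-prefixes⁺ (a ∷ w) []      s e = here refl
∈-prefixes⁺ (a ∷ w) (b ∷ u) s e with ∷-injective e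
... | refl , e′ = there (∈-map⁺ (a ∷_) (∈-prefixes⁺ w u s e′))

∈-factors⁻ : ∀ w {u} → u ∈ factors w → Factor u w
∈-factors⁻ []      (here refl) = [] , [] , refl
∈-factors⁻ (a ∷ w) m with ∈-++⁻ (prefixes (a ∷ w)) m
... | inj₁ m′ = [] , ∈-prefixes⁻ (a ∷ w) m′
... | inj₂ m′ = factor-∷ a (∈-factors⁻ w m′)

∈-factors⁺ : ∀ w {u} → Factor u w → u ∈ factors w
∈-factors⁺ []      {u} ([] , s , e) with ++-conicalˡ u s e
... | refl = here refl
∈-factors⁺ (a ∷ w) {u} ([] , s , e) = ∈-++⁺ˡ (∈-prefixes⁺ (a ∷ w) u s e)
∈-factors⁺ (a ∷ w) (b ∷ p , s , e) with ∷-injective e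
... | refl , e′ = ∈-++⁺ʳ (prefixes (a ∷ w)) (∈-factors⁺ w (p , s , e′))

factor? : (u w : Word) → Dec (Factor u w)
factor? u w with any? (u ≟ʷ_) (factors w)
... | yes m = yes (∈-factors⁻ w m)
... | no ¬m = no (λ f → ¬m (∈-factors⁺ w f))

factor-occurrences : ∀ c {u w} → Factor u w → occurrences c u ≤ occurrences c w
factor-occurrences c {u} (p , s , refl) = begin
  occurrences c u                                       ≤⟨ m≤m+n _ _ ⟩
  occurrences c u + occurrences c s                     ≡⟨ occurrences-++ c u s ⟨
  occurrences c (u ++ s)                                ≤⟨ m≤n+m _ _ ⟩
  occurrences c p + occurrences c (u ++ s)              ≡⟨ occurrences-++ c p (u ++ s) ⟨
  occurrences c (p ++ u ++ s)                           ∎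
  where open ≤-Reasoning

factor-behind-head : ∀ v {u t a w} → NonEmpty v → v ++ u ++ t ≡ a ∷ w → Factor u w
factor-behind-head (c ∷ r) _ e = r , _ , ∷-injectiveʳ e

-- Palindromic complexity

palindrome? : (u : Word) → Dec (NonEmpty u × Palindrome u)
palindrome? u = (1 ≤? length u) ×-dec (reverse u ≟ʷ u)

palindromes : Word → List Word
palindromes w = deduplicate _≟ʷ_ (filter palindrome? (factors w))

∈-palindromes⁻ : ∀ w {u} → u ∈ palindromes w → PalFactor w u
∈-palindromes⁻ w m with ∈-filter⁻ palindrome? (∈-deduplicate⁻ _≟ʷ_ _ m)
... | m′ , (ne , pal) = ne , pal , ∈-factors⁻ w m′

∈-palindromes⁺ : ∀ w {u} → PalFactor w u → u ∈ palindromes w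
∈-palindromes⁺ w (ne , pal , f) =
  ∈-deduplicate⁺ _≟ʷ_ (∈-filter⁺ palindrome? (∈-factors⁺ w f) (ne , pal))

palindromes-unique : ∀ w → Unique (palindromes w)
palindromes-unique w = deduplicate-! _≟ʷ_ _

palCount : Word → ℕ
palCount w = length (palindromes w)

Full : Word → Set
Full w = palCount w ≡ length w

palCount-mono : ∀ {v w} → (∀ {u} → PalFactor v u → PalFactor w u) → palCount v ≤ palCount w
palCount-mono {v} {w} sub =
  unique-⊆⇒length≤ (palindromes-unique v) (λ m → ∈-palindromes⁺ w (sub (∈-palindromes⁻ v m)))

rich⇒full : ∀ w → Rich w → Full w
rich⇒full w (L , L! , L⇔ , e) = trans (≤-antisym
  (unique-⊆⇒length≤ (palindromes-unique w) (λ m → Equivalence.from (L⇔ _) (∈-palindromes⁻ w m)))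
  (unique-⊆⇒length≤ L! (λ m → ∈-palindromes⁺ w (Equivalence.to (L⇔ _) m)))) e

full⇒rich : ∀ w → Full w → Rich w
full⇒rich w e = palindromes w , palindromes-unique w ,
  (λ u → mk⇔ (∈-palindromes⁻ w) (∈-palindromes⁺ w)) , e

-- A shorter palindromic prefix of a palindrome reappears at its end, hence strictly inside.
palindromic-prefix-recurs : ∀ {a w u b m t} → Palindrome u → Palindrome (u ++ b ∷ m) →
                            (u ++ b ∷ m) ++ t ≡ a ∷ w → Factor u w
palindromic-prefix-recurs {a} {w} {u} {b} {m} {t} pu pum e =
  factor-behind-head (reverse (b ∷ m)) (subst (0 <_) (sym (length-reverse (b ∷ m))) (s≤s z≤n)) (begin
    reverse (b ∷ m) ++ u ++ t             ≡⟨ ++-assoc (reverse (b ∷ m)) u t ⟨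
    (reverse (b ∷ m) ++ u) ++ t           ≡⟨ cong (λ z → (reverse (b ∷ m) ++ z) ++ t) pu ⟨
    (reverse (b ∷ m) ++ reverse u) ++ t   ≡⟨ cong (_++ t) (reverse-++ u (b ∷ m)) ⟨
    reverse (u ++ b ∷ m) ++ t             ≡⟨ cong (_++ t) pum ⟩
    (u ++ b ∷ m) ++ t                     ≡⟨ e ⟩
    a ∷ w                                 ∎)
  where open ≡-Reasoning

new-palindromes-equal : ∀ {a w u u′} → PalFactor (a ∷ w) u → PalFactor (a ∷ w) u′ →
                        ¬ Factor u w → ¬ Factor u′ w → u ≡ u′
new-palindromes-equal (_ , pu , fu) (_ , pu′ , fu′) ¬fu ¬fu′
  with factor-∷⁻ fu | factor-∷⁻ fu′
... | inj₁ f | _      = ⊥-elim (¬fu f)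
... | inj₂ _ | inj₁ f = ⊥-elim (¬fu′ f)
... | inj₂ (t , e) | inj₂ (t′ , e′) with ++-split _ t _ t′ (trans e (sym e′))
...   | inj₁ ([]    , refl , _) = sym (++-identityʳ _)
...   | inj₁ (b ∷ m , refl , _) = ⊥-elim (¬fu (palindromic-prefix-recurs pu pu′ e′))
...   | inj₂ (_ , _ , refl , _)  = ⊥-elim (¬fu′ (palindromic-prefix-recurs pu′ pu e))

palCount-∷ : ∀ a w → palCount (a ∷ w) ≤ suc (palCount w)
palCount-∷ a w with any? (λ u → ¬? (factor? u w)) (palindromes (a ∷ w))
... | yes new with find new
...   | P , P∈ , ¬fP = unique-⊆⇒length≤ (palindromes-unique (a ∷ w)) sub
  where
  sub : ∀ {u} → u ∈ palindromes (a ∷ w) → u ∈ P ∷ palindromes w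
  sub {u} m with ∈-palindromes⁻ (a ∷ w) m | factor? u w
  ... | ne , pal , _ | yes f = there (∈-palindromes⁺ w (ne , pal , f))
  ... | pf           | no ¬f = here (new-palindromes-equal pf (∈-palindromes⁻ (a ∷ w) P∈) ¬f ¬fP)
palCount-∷ a w | no ¬new = m≤n⇒m≤1+n (palCount-mono old)
  where
  old : ∀ {u} → PalFactor (a ∷ w) u → PalFactor w u
  old {u} (ne , pal , f) with factor? u w
  ... | yes f′ = ne , pal , f′
  ... | no ¬f  = ⊥-elim (¬new (lose (∈-palindromes⁺ (a ∷ w) (ne , pal , f)) ¬f))

palCount-∷-new : ∀ {a w P} → PalFactor (a ∷ w) P → ¬ Factor P w → suc (palCount w) ≤ palCount (a ∷ w)
palCount-∷-new {a} {w} {P} pf ¬fP =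
  unique-⊆⇒length≤ (All.tabulate (λ m P≡ → ¬fP (subst (λ z → Factor z w) (sym P≡) (proj₂ (proj₂ (∈-palindromes⁻ w m)))))
                    ∷ palindromes-unique w) sub
  where
  sub : ∀ {u} → u ∈ P ∷ palindromes w → u ∈ palindromes (a ∷ w)
  sub (here refl) = ∈-palindromes⁺ (a ∷ w) pf
  sub (there m) with ∈-palindromes⁻ w m
  ... | ne , pal , f = ∈-palindromes⁺ (a ∷ w) (ne , pal , factor-∷ a f)

palCount≤length : ∀ w → palCount w ≤ length w
palCount≤length []      = z≤n
palCount≤length (a ∷ w) = ≤-trans (palCount-∷ a w) (s≤s (palCount≤length w))

palCount-reverse : ∀ w → palCount (reverse w) ≡ palCount w
palCount-reverse w = ≤-antisym (palCount-mono to) (palCount-mono from)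
  where
  to : ∀ {u} → PalFactor (reverse w) u → PalFactor w u
  to (ne , pal , f) = ne , pal , factor-reverse⁻ (subst (λ z → Factor z (reverse w)) (sym pal) f)
  from : ∀ {u} → PalFactor w u → PalFactor (reverse w) u
  from (ne , pal , f) = ne , pal , subst (λ z → Factor z (reverse w)) pal (factor-reverse f)

full-reverse : ∀ w → Full w → Full (reverse w)
full-reverse w e = trans (palCount-reverse w) (trans e (sym (length-reverse w)))

full-∷ : ∀ {a w P} → Full w → PalFactor (a ∷ w) P → ¬ Factor P w → Full (a ∷ w)
full-∷ {a} {w} e pf ¬fP =
  ≤-antisym (palCount≤length (a ∷ w)) (subst (λ n → suc n ≤ palCount (a ∷ w)) e (palCount-∷-new pf ¬fP))

full-∷ʳ : ∀ {a w P} → Full w → PalFactor (w ++ [ a ]) P → ¬ Factor P w → Full (w ++ [ a ])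
full-∷ʳ {a} {w} {P} e (ne , pal , f) ¬fP =
  subst Full (trans (unfold-reverse a (reverse w)) (cong (_++ [ a ]) (reverse-involutive w)))
    (full-reverse (a ∷ reverse w) (full-∷ {a} {reverse w} {P} (full-reverse w e)
      (ne , pal , subst₂ Factor pal (reverse-++ w [ a ]) (factor-reverse f))
      (λ g → ¬fP (factor-reverse⁻ (subst (λ z → Factor z (reverse w)) (sym pal) g)))))

palCount-++ˡ : ∀ p u → palCount (p ++ u) ≤ length p + palCount u
palCount-++ˡ []      u = ≤-refl
palCount-++ˡ (a ∷ p) u = ≤-trans (palCount-∷ a (p ++ u)) (s≤s (palCount-++ˡ p u))

palCount-++ʳ : ∀ u s → palCount (u ++ s) ≤ length s + palCount u
palCount-++ʳ u s = begin
  palCount (u ++ s)                         ≡⟨ palCount-reverse (u ++ s) ⟨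
  palCount (reverse (u ++ s))               ≡⟨ cong palCount (reverse-++ u s) ⟩
  palCount (reverse s ++ reverse u)         ≤⟨ palCount-++ˡ (reverse s) (reverse u) ⟩
  length (reverse s) + palCount (reverse u) ≡⟨ cong₂ _+_ (length-reverse s) (palCount-reverse u) ⟩
  length s + palCount u                     ∎
  where open ≤-Reasoning

full-factor : ∀ {u w} → Factor u w → Full w → Full u
full-factor {u} (p , s , refl) e = ≤-antisym (palCount≤length u) (+-cancelˡ-≤ (length p + length s) _ _ (begin
  length p + length s + length u        ≡⟨ +-assoc (length p) (length s) (length u) ⟩
  length p + (length s + length u)      ≡⟨ cong (length p +_) (+-comm (length s) (length u)) ⟩
  length p + (length u + length s)      ≡⟨ cong (length p +_) (length-++ u) ⟨
  length p + length (u ++ s)            ≡⟨ length-++ p ⟨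
  length (p ++ u ++ s)                  ≡⟨ e ⟨
  palCount (p ++ u ++ s)                ≤⟨ palCount-++ˡ p (u ++ s) ⟩
  length p + palCount (u ++ s)          ≤⟨ +-monoʳ-≤ (length p) (palCount-++ʳ u s) ⟩
  length p + (length s + palCount u)    ≡⟨ +-assoc (length p) (length s) (palCount u) ⟨
  length p + length s + palCount u      ∎))
  where open ≤-Reasoning

full-^ : ∀ c n → Full (c ^ n)
full-^ c zero    = refl
full-^ c (suc n) = subst Full (^-∷ʳ c n)
  (full-∷ʳ (full-^ c n) (s≤s z≤n , reverse-^ c (suc n) , [] , [] , trans (++-identityʳ _) (sym (^-∷ʳ c n)))
     λ f → 1+n≰n (subst₂ _≤_ (occurrences-^ c (suc n)) (occurrences-^ c n) (factor-occurrences c f)))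

full-prefix : ∀ {u w} s → u ++ s ≡ w → Full w → Full u
full-prefix s eq = full-factor ([] , s , eq)

full? : ∀ w → Dec (Full w)
full? w = palCount w ≟ length w

-- Words over {x, y} as run lengths

module Runs (x y : Letter) (x≢y : x ≢ y) where

  -- runs a₀ (a₁ ∷ ⋯ ∷ aₖ) = x^a₀ y x^a₁ y ⋯ y x^aₖ; a y-block of length p shows as p - 1 zero runs.
  runs : ℕ → List ℕ → Word
  runs a []       = x ^ a
  runs a (b ∷ bs) = x ^ a ++ y ∷ runs b bs

  yRuns : List ℕ → Word
  yRuns []       = []
  yRuns (a ∷ as) = y ∷ runs a as

  runs≡x^++yRuns : ∀ a as → runs a as ≡ x ^ a ++ yRuns as
  runs≡x^++yRuns a []      = sym (++-identityʳ (x ^ a))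
  runs≡x^++yRuns a (_ ∷ _) = refl

  x^++runs : ∀ k a as → x ^ k ++ runs a as ≡ runs (k + a) as
  x^++runs k a as = begin
    x ^ k ++ runs a as            ≡⟨ cong (x ^ k ++_) (runs≡x^++yRuns a as) ⟩
    x ^ k ++ x ^ a ++ yRuns as    ≡⟨ ++-assoc (x ^ k) (x ^ a) (yRuns as) ⟨
    (x ^ k ++ x ^ a) ++ yRuns as  ≡⟨ cong (_++ yRuns as) (^-+ x k a) ⟨
    x ^ (k + a) ++ yRuns as       ≡⟨ runs≡x^++yRuns (k + a) as ⟨
    runs (k + a) as               ∎
    where open ≡-Reasoning

  runs-++ : ∀ a b bs s → runs a (b ∷ bs) ++ s ≡ x ^ a ++ y ∷ (runs b bs ++ s)
  runs-++ a b bs s = ++-assoc (x ^ a) (y ∷ runs b bs) s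

  x^y-injective : ∀ m n v w → x ^ m ++ y ∷ v ≡ x ^ n ++ y ∷ w → m ≡ n × v ≡ w
  x^y-injective zero    zero    v w e = refl , proj₂ (∷-injective e)
  x^y-injective zero    (suc n) v w e = ⊥-elim (x≢y (sym (proj₁ (∷-injective e))))
  x^y-injective (suc m) zero    v w e = ⊥-elim (x≢y (proj₁ (∷-injective e)))
  x^y-injective (suc m) (suc n) v w e with x^y-injective m n v w (proj₂ (∷-injective e))
  ... | refl , v≡w = refl , v≡w

  x^-prefix-of-x^y : ∀ m n v w → x ^ m ++ v ≡ x ^ n ++ y ∷ w → m ≤ n
  x^-prefix-of-x^y zero    n       v w e = z≤n
  x^-prefix-of-x^y (suc m) zero    v w e = ⊥-elim (x≢y (proj₁ (∷-injective e)))
  x^-prefix-of-x^y (suc m) (suc n) v w e = s≤s (x^-prefix-of-x^y m n v w (proj₂ (∷-injective e)))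

  x^-prefix-of-x^ : ∀ m n v → x ^ m ++ v ≡ x ^ n → m ≤ n
  x^-prefix-of-x^ zero    n       v e = z≤n
  x^-prefix-of-x^ (suc m) (suc n) v e = s≤s (x^-prefix-of-x^ m n v (proj₂ (∷-injective e)))

  x^y≢x^ : ∀ m n w → x ^ m ++ y ∷ w ≢ x ^ n
  x^y≢x^ zero    (suc n) w e = x≢y (sym (proj₁ (∷-injective e)))
  x^y≢x^ (suc m) (suc n) w e = x^y≢x^ m n w (proj₂ (∷-injective e))

  x^-suffix : ∀ n p v → x ^ n ≡ p ++ v → ∃[ k ] (v ≡ x ^ k × k ≤ n)
  x^-suffix n       []      v e = n , sym e , ≤-refl
  x^-suffix (suc n) (c ∷ p) v e with x^-suffix n p v (proj₂ (∷-injective e))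
  ... | k , v≡ , k≤n = k , v≡ , m≤n⇒m≤1+n k≤n

  PrefixRuns : ℕ → List ℕ → ℕ → List ℕ → Set
  PrefixRuns b []        a as        = b ≤ a
  PrefixRuns b (_ ∷ _)   a []        = ⊥
  PrefixRuns b (b′ ∷ bs) a (a′ ∷ as) = b ≡ a × PrefixRuns b′ bs a′ as

  TailPrefixRuns : List ℕ → List ℕ → Set
  TailPrefixRuns []       _        = ⊤
  TailPrefixRuns (_ ∷ _)  []       = ⊥
  TailPrefixRuns (b ∷ bs) (a ∷ as) = PrefixRuns b bs a as

  -- An occurrence of runs b bs in runs a as: its first run is a suffix of some x-run aᵢ and
  -- the remaining runs match from aᵢ₊₁ on.
  FactorRuns : ℕ → List ℕ → ℕ → List ℕ → Set
  FactorRuns b bs a []        = b ≤ a × TailPrefixRuns bs []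
  FactorRuns b bs a (a′ ∷ as) = (b ≤ a × TailPrefixRuns bs (a′ ∷ as)) ⊎ FactorRuns b bs a′ as

  prefix⇒PrefixRuns : ∀ b bs a as s → runs b bs ++ s ≡ runs a as → PrefixRuns b bs a as
  prefix⇒PrefixRuns b []        a []        s e = x^-prefix-of-x^ b a s e
  prefix⇒PrefixRuns b []        a (_ ∷ _)   s e = x^-prefix-of-x^y b a s _ e
  prefix⇒PrefixRuns b (b′ ∷ bs) a []        s e = ⊥-elim (x^y≢x^ b a _ (trans (sym (runs-++ b b′ bs s)) e))
  prefix⇒PrefixRuns b (b′ ∷ bs) a (a′ ∷ as) s e with x^y-injective b a _ _ (trans (sym (runs-++ b b′ bs s)) e)
  ... | b≡a , e′ = b≡a , prefix⇒PrefixRuns b′ bs a′ as s e′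

  PrefixRuns⇒prefix : ∀ b bs a as → PrefixRuns b bs a as → ∃[ s ] (runs b bs ++ s ≡ runs a as)
  PrefixRuns⇒prefix b []        a as b≤a = x ^ (a ∸ b) ++ yRuns as , (begin
    x ^ b ++ x ^ (a ∸ b) ++ yRuns as ≡⟨ cong (x ^ b ++_) (runs≡x^++yRuns (a ∸ b) as) ⟨
    x ^ b ++ runs (a ∸ b) as         ≡⟨ x^++runs b (a ∸ b) as ⟩
    runs (b + (a ∸ b)) as            ≡⟨ cong (λ n → runs n as) (m+[n∸m]≡n b≤a) ⟩
    runs a as                        ∎)
    where open ≡-Reasoning
  PrefixRuns⇒prefix b (b′ ∷ bs) a (a′ ∷ as) (refl , p) with PrefixRuns⇒prefix b′ bs a′ as p
  ... | s , e = s , trans (runs-++ b b′ bs s) (cong (λ w → x ^ b ++ y ∷ w) e)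

  PrefixRuns⇒head : ∀ {b bs k as} → PrefixRuns b bs k as → b ≤ k × TailPrefixRuns bs as
  PrefixRuns⇒head {bs = []}                   b≤k        = b≤k , tt
  PrefixRuns⇒head {bs = _ ∷ _} {as = _ ∷ _} (refl , p) = ≤-refl , p

  TailPrefixRuns⇒PrefixRuns : ∀ {b bs as} → TailPrefixRuns bs as → PrefixRuns b bs b as
  TailPrefixRuns⇒PrefixRuns {bs = []}                   _ = ≤-refl
  TailPrefixRuns⇒PrefixRuns {bs = _ ∷ _} {as = _ ∷ _} p = refl , p

  FactorRuns-here : ∀ {b bs a} as → b ≤ a → TailPrefixRuns bs as → FactorRuns b bs a as
  FactorRuns-here []      b≤a t = b≤a , t
  FactorRuns-here (_ ∷ _) b≤a t = inj₁ (b≤a , t)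

  factor⇒FactorRuns : ∀ b bs a as p s → p ++ runs b bs ++ s ≡ runs a as → FactorRuns b bs a as
  factor⇒FactorRuns b bs a as p s e
    with ++-split p (runs b bs ++ s) (x ^ a) (yRuns as) (trans e (runs≡x^++yRuns a as))
  ... | inj₁ (m , x^a≡ , rest) with x^-suffix a p m x^a≡
  ...   | k , refl , k≤a with PrefixRuns⇒head (prefix⇒PrefixRuns b bs k as s (trans rest (sym (runs≡x^++yRuns k as))))
  ...     | b≤k , t = FactorRuns-here as (≤-trans b≤k k≤a) t
  factor⇒FactorRuns b bs a (a′ ∷ as) p s e | inj₂ (_ , m , _ , ys≡) =
    inj₂ (factor⇒FactorRuns b bs a′ as m s (sym (proj₂ (∷-injective ys≡))))

  aligned⇒factor : ∀ b bs a as → b ≤ a → TailPrefixRuns bs as → Factor (runs b bs) (runs a as)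
  aligned⇒factor b bs a as b≤a t with PrefixRuns⇒prefix b bs b as (TailPrefixRuns⇒PrefixRuns t)
  ... | s , e = x ^ (a ∸ b) , s , (begin
    x ^ (a ∸ b) ++ runs b bs ++ s ≡⟨ cong (x ^ (a ∸ b) ++_) e ⟩
    x ^ (a ∸ b) ++ runs b as      ≡⟨ x^++runs (a ∸ b) b as ⟩
    runs (a ∸ b + b) as           ≡⟨ cong (λ n → runs n as) (m∸n+n≡m b≤a) ⟩
    runs a as                     ∎)
    where open ≡-Reasoning

  FactorRuns⇒factor : ∀ b bs a as → FactorRuns b bs a as → Factor (runs b bs) (runs a as)
  FactorRuns⇒factor b bs a []        (b≤a , t)        = aligned⇒factor b bs a [] b≤a t
  FactorRuns⇒factor b bs a (a′ ∷ as) (inj₁ (b≤a , t)) = aligned⇒factor b bs a (a′ ∷ as) b≤a t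
  FactorRuns⇒factor b bs a (a′ ∷ as) (inj₂ f) with FactorRuns⇒factor b bs a′ as f
  ... | p , s , e = x ^ a ++ y ∷ p , s , trans (++-assoc (x ^ a) (y ∷ p) _) (cong (λ w → x ^ a ++ y ∷ w) e)

  runsL : List ℕ → Word
  runsL []       = []
  runsL (a ∷ as) = runs a as

  x∷runs : ∀ a as → x ∷ runs a as ≡ runs (suc a) as
  x∷runs a []      = refl
  x∷runs a (_ ∷ _) = refl

  runsL-∷ʳ : ∀ as t → as ≢ [] → runsL (as ∷ʳ t) ≡ runsL as ++ y ∷ x ^ t
  runsL-∷ʳ []           t as≢[] = ⊥-elim (as≢[] refl)
  runsL-∷ʳ (a ∷ [])     t _     = refl
  runsL-∷ʳ (a ∷ b ∷ as) t _     = trans (cong (λ w → x ^ a ++ y ∷ w) (runsL-∷ʳ (b ∷ as) t (λ ())))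
                                        (sym (runs-++ a b as (y ∷ x ^ t)))

  reverse-runsL : ∀ as → reverse (runsL as) ≡ runsL (reverse as)
  reverse-runsL []           = refl
  reverse-runsL (a ∷ [])     = reverse-^ x a
  reverse-runsL (a ∷ b ∷ as) = begin
    reverse (x ^ a ++ y ∷ runs b as)           ≡⟨ reverse-++ (x ^ a) (y ∷ runs b as) ⟩
    reverse (y ∷ runs b as) ++ reverse (x ^ a) ≡⟨ cong₂ _++_ (unfold-reverse y (runs b as)) (reverse-^ x a) ⟩
    (reverse (runs b as) ++ [ y ]) ++ x ^ a    ≡⟨ ++-assoc (reverse (runs b as)) [ y ] (x ^ a) ⟩
    reverse (runs b as) ++ y ∷ x ^ a           ≡⟨ cong (_++ y ∷ x ^ a) (reverse-runsL (b ∷ as)) ⟩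
    runsL (reverse (b ∷ as)) ++ y ∷ x ^ a      ≡⟨ runsL-∷ʳ (reverse (b ∷ as)) a reverse≢[] ⟨
    runsL (reverse (b ∷ as) ∷ʳ a)              ≡⟨ cong runsL (unfold-reverse a (b ∷ as)) ⟨
    runsL (reverse (a ∷ b ∷ as))               ∎
    where
    open ≡-Reasoning
    reverse≢[] : reverse (b ∷ as) ≢ []
    reverse≢[] e with trans (sym (length-reverse (b ∷ as))) (cong length e)
    ... | ()

  full-x∷-longest-run : ∀ s as → All (_≤ s) as → Full (runs s as) → Full (runs (suc s) as)
  full-x∷-longest-run s as as≤s full = subst Full (x∷runs s as)
    (full-∷ full (s≤s z≤n , reverse-^ x (suc s) , subst (Factor (x ^ suc s)) (sym (x∷runs s as)) x^1+s-factor)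
      (λ f → not-in-runs s as ≤-refl as≤s (factor⇒FactorRuns (suc s) [] s as _ _ (proj₂ (proj₂ f)))))
    where
    x^1+s-factor : Factor (x ^ suc s) (runs (suc s) as)
    x^1+s-factor = aligned⇒factor (suc s) [] (suc s) as ≤-refl tt
    not-in-runs : ∀ a as → a ≤ s → All (_≤ s) as → ¬ FactorRuns (suc s) [] a as
    not-in-runs a []        a≤s _          (s<a , _)        = <⇒≱ s<a a≤s
    not-in-runs a (_ ∷ _)   a≤s _          (inj₁ (s<a , _)) = <⇒≱ s<a a≤s
    not-in-runs a (a′ ∷ as) _   (a′≤s ∷ ≤s) (inj₂ f)         = not-in-runs a′ as a′≤s ≤s f

  full-y^x^ : ∀ p t → Full (y ^ p ++ x ^ t)
  full-y^x^ p zero    = subst Full (sym (++-identityʳ (y ^ p))) (full-^ y p)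
  full-y^x^ p (suc t) = subst Full grown
    (full-∷ʳ (full-y^x^ p t) (s≤s z≤n , reverse-^ x (suc t) , y ^ p , [] , trans (cong (y ^ p ++_) (++-identityʳ (x ^ suc t))) (sym grown))
      (λ f → 1+n≰n (subst₂ _≤_ (occurrences-^ x (suc t)) x-count (factor-occurrences x f))))
    where
    grown : (y ^ p ++ x ^ t) ++ [ x ] ≡ y ^ p ++ x ^ suc t
    grown = trans (++-assoc (y ^ p) (x ^ t) [ x ]) (cong (y ^ p ++_) (^-∷ʳ x t))
    x-count : occurrences x (y ^ p ++ x ^ t) ≡ t
    x-count = trans (occurrences-++ x (y ^ p) (x ^ t))
                    (cong₂ _+_ (occurrences-^-≢ x≢y p) (occurrences-^ x t))

-- Symbolic certificates for families of words

-- (c₀ ∷ ⋯ ∷ cₙ , k) denotes c₀ρ₀ + ⋯ + cₙρₙ + k.  Evaluation skips zero coefficients and unit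
-- factors and nests sums to the left, so that a concrete form evaluates definitionally to the term
-- used in the statements (e.g. suc (s + m) rather than 1 * s + (1 * m + 0) + 1).
Lin : Set
Lin = List ℕ × ℕ

times : ℕ → ℕ → ℕ
times zero          r = 0
times (suc zero)    r = r
times (suc (suc c)) r = r + times (suc c) r

_⊕_ : Maybe ℕ → ℕ → ℕ
nothing ⊕ v = v
just u  ⊕ v = u + v

linearPartFrom : Maybe ℕ → List ℕ → List ℕ → Maybe ℕ
linearPartFrom acc []           ρ       = acc
linearPartFrom acc (c ∷ cs)     []      = acc
linearPartFrom acc (zero ∷ cs)  (r ∷ ρ) = linearPartFrom acc cs ρ
linearPartFrom acc (suc c ∷ cs) (r ∷ ρ) = linearPartFrom (just (acc ⊕ times (suc c) r)) cs ρ

linearPart : List ℕ → List ℕ → Maybe ℕ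
linearPart = linearPartFrom nothing

_+ᵐ_ : Maybe ℕ → ℕ → ℕ
nothing +ᵐ k     = k
just v  +ᵐ zero  = v
just v  +ᵐ suc k = suc (just v +ᵐ k)

⟦_⟧ˡ : Lin → List ℕ → ℕ
⟦ cs , k ⟧ˡ ρ = linearPart cs ρ +ᵐ k

dot : List ℕ → List ℕ → ℕ
dot []       ρ       = 0
dot (c ∷ cs) []      = 0
dot (c ∷ cs) (r ∷ ρ) = c * r + dot cs ρ

times≡* : ∀ c r → times c r ≡ c * r
times≡* zero          r = refl
times≡* (suc zero)    r = sym (+-identityʳ r)
times≡* (suc (suc c)) r = cong (r +_) (times≡* (suc c) r)

⊕≡+ : ∀ m v → m ⊕ v ≡ (m +ᵐ 0) + v
⊕≡+ nothing  v = refl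
⊕≡+ (just u) v = refl

linearPartFrom≡dot : ∀ acc cs ρ → linearPartFrom acc cs ρ +ᵐ 0 ≡ (acc +ᵐ 0) + dot cs ρ
linearPartFrom≡dot acc []           ρ       = sym (+-identityʳ _)
linearPartFrom≡dot acc (c ∷ cs)     []      = sym (+-identityʳ _)
linearPartFrom≡dot acc (zero ∷ cs)  (r ∷ ρ) = linearPartFrom≡dot acc cs ρ
linearPartFrom≡dot acc (suc c ∷ cs) (r ∷ ρ) = begin
  linearPartFrom (just (acc ⊕ times (suc c) r)) cs ρ +ᵐ 0 ≡⟨ linearPartFrom≡dot _ cs ρ ⟩
  (acc ⊕ times (suc c) r) + dot cs ρ                    ≡⟨ cong (_+ dot cs ρ) (⊕≡+ acc _) ⟩
  (acc +ᵐ 0) + times (suc c) r + dot cs ρ               ≡⟨ +-assoc (acc +ᵐ 0) _ (dot cs ρ) ⟩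
  (acc +ᵐ 0) + (times (suc c) r + dot cs ρ)             ≡⟨ cong (λ n → (acc +ᵐ 0) + (n + dot cs ρ)) (times≡* (suc c) r) ⟩
  (acc +ᵐ 0) + (suc c * r + dot cs ρ)                   ∎
  where open ≡-Reasoning

linearPart≡dot : ∀ cs ρ → linearPart cs ρ +ᵐ 0 ≡ dot cs ρ
linearPart≡dot = linearPartFrom≡dot nothing

+ᵐ-suc : ∀ m k → m +ᵐ suc k ≡ suc (m +ᵐ k)
+ᵐ-suc nothing  k = refl
+ᵐ-suc (just v) k = refl

+ᵐ≡+ : ∀ m k → m +ᵐ k ≡ (m +ᵐ 0) + k
+ᵐ≡+ nothing  k       = refl
+ᵐ≡+ (just v) zero    = sym (+-identityʳ v)
+ᵐ≡+ (just v) (suc k) = trans (cong suc (+ᵐ≡+ (just v) k)) (sym (+-suc v k))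

⟦⟧ˡ≡ : ∀ cs k ρ → ⟦ cs , k ⟧ˡ ρ ≡ dot cs ρ + k
⟦⟧ˡ≡ cs k ρ = trans (+ᵐ≡+ (linearPart cs ρ) k) (cong (_+ k) (linearPart≡dot cs ρ))

incˡ : Lin → Lin
incˡ (cs , k) = cs , suc k

⟦incˡ⟧ : ∀ a ρ → ⟦ incˡ a ⟧ˡ ρ ≡ suc (⟦ a ⟧ˡ ρ)
⟦incˡ⟧ (cs , k) ρ = +ᵐ-suc (linearPart cs ρ) k

coeffs≤ : List ℕ → List ℕ → Bool
coeffs≤ []       ds       = true
coeffs≤ (c ∷ cs) []       = (c ≡ᵇ 0) ∧ coeffs≤ cs []
coeffs≤ (c ∷ cs) (d ∷ ds) = (c ≤ᵇ d) ∧ coeffs≤ cs ds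

coeffs≤-sound : ∀ cs ds ρ → T (coeffs≤ cs ds) → dot cs ρ ≤ dot ds ρ
coeffs≤-sound []           ds       ρ       _ = z≤n
coeffs≤-sound (c ∷ cs)     ds       []      _ = z≤n
coeffs≤-sound (zero ∷ cs)  []       (r ∷ ρ) h = coeffs≤-sound cs [] ρ (proj₂ (Equivalence.to T-∧ h))
coeffs≤-sound (c ∷ cs)     (d ∷ ds) (r ∷ ρ) h with Equivalence.to (T-∧ {c ≤ᵇ d}) h
... | c≤d , rest = +-mono-≤ (*-monoˡ-≤ r (≤ᵇ⇒≤ c d c≤d)) (coeffs≤-sound cs ds ρ rest)

-- Sound but incomplete: true certifies the relation for every valuation ρ.
infix 4 _≤ˡ_ _<ˡ_ _≡ˡ_ _≢ˡ_
_≤ˡ_ _<ˡ_ _≡ˡ_ _≢ˡ_ : Lin → Lin → Bool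
(cs , k) ≤ˡ (ds , l) = coeffs≤ cs ds ∧ (k ≤ᵇ l)
(cs , k) <ˡ (ds , l) = coeffs≤ cs ds ∧ (suc k ≤ᵇ l)
a ≡ˡ b = (a ≤ˡ b) ∧ (b ≤ˡ a)
a ≢ˡ b = (a <ˡ b) ∨ (b <ˡ a)

≤ˡ-sound : ∀ a b ρ → T (a ≤ˡ b) → ⟦ a ⟧ˡ ρ ≤ ⟦ b ⟧ˡ ρ
≤ˡ-sound (cs , k) (ds , l) ρ h with Equivalence.to (T-∧ {coeffs≤ cs ds}) h
... | h₁ , h₂ = subst₂ _≤_ (sym (⟦⟧ˡ≡ cs k ρ)) (sym (⟦⟧ˡ≡ ds l ρ))
                  (+-mono-≤ (coeffs≤-sound cs ds ρ h₁) (≤ᵇ⇒≤ k l h₂))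

<ˡ-sound : ∀ a b ρ → T (a <ˡ b) → ⟦ a ⟧ˡ ρ < ⟦ b ⟧ˡ ρ
<ˡ-sound (cs , k) (ds , l) ρ h with Equivalence.to (T-∧ {coeffs≤ cs ds}) h
... | h₁ , h₂ = subst₂ _<_ (sym (⟦⟧ˡ≡ cs k ρ)) (sym (⟦⟧ˡ≡ ds l ρ))
                  (subst (_≤ dot ds ρ + l) (+-suc (dot cs ρ) k)
                    (+-mono-≤ (coeffs≤-sound cs ds ρ h₁) (≤ᵇ⇒≤ (suc k) l h₂)))

≡ˡ-sound : ∀ a b ρ → T (a ≡ˡ b) → ⟦ a ⟧ˡ ρ ≡ ⟦ b ⟧ˡ ρ
≡ˡ-sound a b ρ h with Equivalence.to (T-∧ {a ≤ˡ b}) h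
... | h₁ , h₂ = ≤-antisym (≤ˡ-sound a b ρ h₁) (≤ˡ-sound b a ρ h₂)

≢ˡ-sound : ∀ a b ρ → T (a ≢ˡ b) → ⟦ a ⟧ˡ ρ ≢ ⟦ b ⟧ˡ ρ
≢ˡ-sound a b ρ h e with Equivalence.to (T-∨ {a <ˡ b}) h
... | inj₁ a<b = <-irrefl e (<ˡ-sound a b ρ a<b)
... | inj₂ b<a = <-irrefl (sym e) (<ˡ-sound b a ρ b<a)

#_ : ℕ → Lin
# k = [] , k

ρ₀+_ ρ₀₁+_ ρ₂+_ ρ₀₁₂+_ : ℕ → Lin
ρ₀+ k   = 1 ∷ [] , k
ρ₀₁+ k  = 1 ∷ 1 ∷ [] , k
ρ₂+ k   = 0 ∷ 0 ∷ 1 ∷ [] , k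
ρ₀₁₂+ k = 1 ∷ 1 ∷ 1 ∷ [] , k

module Symbolic (x y : Letter) (x≢y : x ≢ y) where
  open Runs x y x≢y

  -- A shape lists run lengths as in runs: ⟦ # 0 ∷ ρ₀+ 2 ∷ # 0 ∷ [] ⟧ ρ is y x^(ρ₀ + 2) y.
  ⟦_⟧ : List Lin → List ℕ → Word
  ⟦ S ⟧ ρ = runsL (map (λ a → ⟦ a ⟧ˡ ρ) S)

  PrefixRunsᵇ : Lin → List Lin → Lin → List Lin → Bool
  PrefixRunsᵇ b []        a as        = b ≤ˡ a
  PrefixRunsᵇ b (_ ∷ _)   a []        = false
  PrefixRunsᵇ b (b′ ∷ bs) a (a′ ∷ as) = (b ≡ˡ a) ∧ PrefixRunsᵇ b′ bs a′ as

  TailPrefixRunsᵇ : List Lin → List Lin → Bool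
  TailPrefixRunsᵇ []       _        = true
  TailPrefixRunsᵇ (_ ∷ _)  []       = false
  TailPrefixRunsᵇ (b ∷ bs) (a ∷ as) = PrefixRunsᵇ b bs a as

  FactorRunsᵇ : Lin → List Lin → Lin → List Lin → Bool
  FactorRunsᵇ b bs a []        = (b ≤ˡ a) ∧ TailPrefixRunsᵇ bs []
  FactorRunsᵇ b bs a (a′ ∷ as) = ((b ≤ˡ a) ∧ TailPrefixRunsᵇ bs (a′ ∷ as)) ∨ FactorRunsᵇ b bs a′ as

  ¬PrefixRunsᵇ : Lin → List Lin → Lin → List Lin → Bool
  ¬PrefixRunsᵇ b []        a as        = a <ˡ b
  ¬PrefixRunsᵇ b (_ ∷ _)   a []        = true
  ¬PrefixRunsᵇ b (b′ ∷ bs) a (a′ ∷ as) = (b ≢ˡ a) ∨ ¬PrefixRunsᵇ b′ bs a′ as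

  ¬TailPrefixRunsᵇ : List Lin → List Lin → Bool
  ¬TailPrefixRunsᵇ []       _        = false
  ¬TailPrefixRunsᵇ (_ ∷ _)  []       = true
  ¬TailPrefixRunsᵇ (b ∷ bs) (a ∷ as) = ¬PrefixRunsᵇ b bs a as

  ¬FactorRunsᵇ : Lin → List Lin → Lin → List Lin → Bool
  ¬FactorRunsᵇ b bs a []        = (a <ˡ b) ∨ ¬TailPrefixRunsᵇ bs []
  ¬FactorRunsᵇ b bs a (a′ ∷ as) = ((a <ˡ b) ∨ ¬TailPrefixRunsᵇ bs (a′ ∷ as)) ∧ ¬FactorRunsᵇ b bs a′ as

  module _ (ρ : List ℕ) where
    private
      ⟦_⟧ρ : Lin → ℕ
      ⟦ a ⟧ρ = ⟦ a ⟧ˡ ρ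
      ⟦_⟧*ρ : List Lin → List ℕ
      ⟦ as ⟧*ρ = map ⟦_⟧ρ as

    PrefixRunsᵇ-sound : ∀ b bs a as → T (PrefixRunsᵇ b bs a as) → PrefixRuns ⟦ b ⟧ρ ⟦ bs ⟧*ρ ⟦ a ⟧ρ ⟦ as ⟧*ρ
    PrefixRunsᵇ-sound b []        a as        h = ≤ˡ-sound b a ρ h
    PrefixRunsᵇ-sound b (b′ ∷ bs) a (a′ ∷ as) h with Equivalence.to (T-∧ {b ≡ˡ a}) h
    ... | h₁ , h₂ = ≡ˡ-sound b a ρ h₁ , PrefixRunsᵇ-sound b′ bs a′ as h₂

    TailPrefixRunsᵇ-sound : ∀ bs as → T (TailPrefixRunsᵇ bs as) → TailPrefixRuns ⟦ bs ⟧*ρ ⟦ as ⟧*ρ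
    TailPrefixRunsᵇ-sound []       as       h = tt
    TailPrefixRunsᵇ-sound (b ∷ bs) (a ∷ as) h = PrefixRunsᵇ-sound b bs a as h

    FactorRunsᵇ-sound : ∀ b bs a as → T (FactorRunsᵇ b bs a as) → FactorRuns ⟦ b ⟧ρ ⟦ bs ⟧*ρ ⟦ a ⟧ρ ⟦ as ⟧*ρ
    FactorRunsᵇ-sound b bs a [] h with Equivalence.to (T-∧ {b ≤ˡ a}) h
    ... | h₁ , h₂ = ≤ˡ-sound b a ρ h₁ , TailPrefixRunsᵇ-sound bs [] h₂
    FactorRunsᵇ-sound b bs a (a′ ∷ as) h with Equivalence.to (T-∨ {(b ≤ˡ a) ∧ TailPrefixRunsᵇ bs (a′ ∷ as)}) h
    ... | inj₂ h₁ = inj₂ (FactorRunsᵇ-sound b bs a′ as h₁)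
    ... | inj₁ h₁ with Equivalence.to (T-∧ {b ≤ˡ a}) h₁
    ...   | h₂ , h₃ = inj₁ (≤ˡ-sound b a ρ h₂ , TailPrefixRunsᵇ-sound bs (a′ ∷ as) h₃)

    ¬PrefixRunsᵇ-sound : ∀ b bs a as → T (¬PrefixRunsᵇ b bs a as) → ¬ PrefixRuns ⟦ b ⟧ρ ⟦ bs ⟧*ρ ⟦ a ⟧ρ ⟦ as ⟧*ρ
    ¬PrefixRunsᵇ-sound b []        a as        h b≤a = <⇒≱ (<ˡ-sound a b ρ h) b≤a
    ¬PrefixRunsᵇ-sound b (b′ ∷ bs) a (a′ ∷ as) h (b≡a , p) with Equivalence.to (T-∨ {b ≢ˡ a}) h
    ... | inj₁ h₁ = ≢ˡ-sound b a ρ h₁ b≡a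
    ... | inj₂ h₁ = ¬PrefixRunsᵇ-sound b′ bs a′ as h₁ p

    ¬TailPrefixRunsᵇ-sound : ∀ bs as → T (¬TailPrefixRunsᵇ bs as) → ¬ TailPrefixRuns ⟦ bs ⟧*ρ ⟦ as ⟧*ρ
    ¬TailPrefixRunsᵇ-sound (b ∷ bs) (a ∷ as) h = ¬PrefixRunsᵇ-sound b bs a as h

    ¬alignedᵇ-sound : ∀ b bs a as → T ((a <ˡ b) ∨ ¬TailPrefixRunsᵇ bs as) →
                      ¬ (⟦ b ⟧ρ ≤ ⟦ a ⟧ρ × TailPrefixRuns ⟦ bs ⟧*ρ ⟦ as ⟧*ρ)
    ¬alignedᵇ-sound b bs a as h (b≤a , t) with Equivalence.to (T-∨ {a <ˡ b}) h
    ... | inj₁ a<b = <⇒≱ (<ˡ-sound a b ρ a<b) b≤a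
    ... | inj₂ ¬t  = ¬TailPrefixRunsᵇ-sound bs as ¬t t

    ¬FactorRunsᵇ-sound : ∀ b bs a as → T (¬FactorRunsᵇ b bs a as) → ¬ FactorRuns ⟦ b ⟧ρ ⟦ bs ⟧*ρ ⟦ a ⟧ρ ⟦ as ⟧*ρ
    ¬FactorRunsᵇ-sound b bs a []        h f = ¬alignedᵇ-sound b bs a [] h f
    ¬FactorRunsᵇ-sound b bs a (a′ ∷ as) h f with Equivalence.to (T-∧ {(a <ˡ b) ∨ ¬TailPrefixRunsᵇ bs (a′ ∷ as)}) h | f
    ... | h₁ , _  | inj₁ aligned = ¬alignedᵇ-sound b bs a (a′ ∷ as) h₁ aligned
    ... | _  , h₂ | inj₂ later   = ¬FactorRunsᵇ-sound b bs a′ as h₂ later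

  _≡*ˡ_ : List Lin → List Lin → Bool
  []       ≡*ˡ []       = true
  (a ∷ as) ≡*ˡ (b ∷ bs) = (a ≡ˡ b) ∧ (as ≡*ˡ bs)
  _        ≡*ˡ _        = false

  ≡*ˡ-sound : ∀ ρ as bs → T (as ≡*ˡ bs) → map (λ a → ⟦ a ⟧ˡ ρ) as ≡ map (λ a → ⟦ a ⟧ˡ ρ) bs
  ≡*ˡ-sound ρ []       []       _ = refl
  ≡*ˡ-sound ρ (a ∷ as) (b ∷ bs) h with Equivalence.to (T-∧ {a ≡ˡ b}) h
  ... | h₁ , h₂ = cong₂ _∷_ (≡ˡ-sound a b ρ h₁) (≡*ˡ-sound ρ as bs h₂)

  nonEmptyᵇ : List Lin → Bool
  nonEmptyᵇ []          = false
  nonEmptyᵇ (a ∷ [])    = # 0 <ˡ a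
  nonEmptyᵇ (a ∷ _ ∷ _) = true

  NewPalindromeᵇ : (new old P : List Lin) → Bool
  NewPalindromeᵇ (a ∷ as) (o ∷ os) (p ∷ ps) =
    FactorRunsᵇ p ps a as ∧ ¬FactorRunsᵇ p ps o os ∧ (p ∷ ps) ≡*ˡ reverse (p ∷ ps) ∧ nonEmptyᵇ (p ∷ ps)
  NewPalindromeᵇ _ _ _ = false

  NewPalindromeᵇ-sound : ∀ ρ new old P → T (NewPalindromeᵇ new old P) →
                         PalFactor (⟦ new ⟧ ρ) (⟦ P ⟧ ρ) × ¬ Factor (⟦ P ⟧ ρ) (⟦ old ⟧ ρ)
  NewPalindromeᵇ-sound ρ (a ∷ as) (o ∷ os) (p ∷ ps) h
    with Equivalence.to (T-∧ {FactorRunsᵇ p ps a as}) h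
  ... | occ , h₁ with Equivalence.to (T-∧ {¬FactorRunsᵇ p ps o os}) h₁
  ... | ¬occ , h₂ with Equivalence.to (T-∧ {(p ∷ ps) ≡*ˡ reverse (p ∷ ps)}) h₂
  ... | pal , ne =
    (nonEmpty ps ne , palindrome , FactorRuns⇒factor _ _ _ _ (FactorRunsᵇ-sound ρ p ps a as occ)) ,
    λ (pre , suf , e) → ¬FactorRunsᵇ-sound ρ p ps o os ¬occ (factor⇒FactorRuns (f p) (map f ps) (f o) (map f os) pre suf e)
    where
    f : Lin → ℕ
    f a = ⟦ a ⟧ˡ ρ
    palindrome : Palindrome (⟦ p ∷ ps ⟧ ρ)
    palindrome = begin
      reverse (runsL (map f (p ∷ ps)))  ≡⟨ reverse-runsL (map f (p ∷ ps)) ⟩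
      runsL (reverse (map f (p ∷ ps)))  ≡⟨ cong runsL (reverse-map f (p ∷ ps)) ⟨
      runsL (map f (reverse (p ∷ ps)))  ≡⟨ cong runsL (≡*ˡ-sound ρ (p ∷ ps) (reverse (p ∷ ps)) pal) ⟨
      runsL (map f (p ∷ ps))            ∎
      where open ≡-Reasoning
    nonEmpty : ∀ ps → T (nonEmptyᵇ (p ∷ ps)) → NonEmpty (⟦ p ∷ ps ⟧ ρ)
    nonEmpty [] h = subst (0 <_) (sym (length-replicate (f p))) (<ˡ-sound (# 0) p ρ h)
    nonEmpty (q ∷ qs) _ = subst (0 <_) (sym (length-++ (x ^ f p))) (≤-trans (s≤s z≤n) (m≤n+m _ (length (x ^ f p))))

  incLast : List Lin → List Lin
  incLast []           = # 1 ∷ []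
  incLast (a ∷ [])     = incˡ a ∷ []
  incLast (a ∷ b ∷ as) = a ∷ incLast (b ∷ as)

  incHead : List Lin → List Lin
  incHead []       = # 1 ∷ []
  incHead (a ∷ as) = incˡ a ∷ as

  ⟦incLast⟧ : ∀ ρ S → ⟦ S ⟧ ρ ++ [ x ] ≡ ⟦ incLast S ⟧ ρ
  ⟦incLast⟧ ρ []           = refl
  ⟦incLast⟧ ρ (a ∷ [])     = trans (^-∷ʳ x (⟦ a ⟧ˡ ρ)) (cong (x ^_) (sym (⟦incˡ⟧ a ρ)))
  ⟦incLast⟧ ρ (a ∷ b ∷ as) = begin
    ⟦ a ∷ b ∷ as ⟧ ρ ++ [ x ]                   ≡⟨ runs-++ (⟦ a ⟧ˡ ρ) (⟦ b ⟧ˡ ρ) (map (λ a → ⟦ a ⟧ˡ ρ) as) [ x ] ⟩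
    x ^ ⟦ a ⟧ˡ ρ ++ y ∷ (⟦ b ∷ as ⟧ ρ ++ [ x ]) ≡⟨ cong (λ w → x ^ ⟦ a ⟧ˡ ρ ++ y ∷ w) (⟦incLast⟧ ρ (b ∷ as)) ⟩
    x ^ ⟦ a ⟧ˡ ρ ++ y ∷ ⟦ incLast (b ∷ as) ⟧ ρ  ≡⟨ ⟦∷⟧ (incLast (b ∷ as)) (incLast-∷ b as) ⟨
    ⟦ a ∷ incLast (b ∷ as) ⟧ ρ                  ∎
    where
    open ≡-Reasoning
    incLast-∷ : ∀ b as → ∃[ c ] ∃[ cs ] (incLast (b ∷ as) ≡ c ∷ cs)
    incLast-∷ b []       = _ , _ , refl
    incLast-∷ b (_ ∷ _)  = _ , _ , refl
    ⟦∷⟧ : ∀ S → ∃[ c ] ∃[ cs ] (S ≡ c ∷ cs) → ⟦ a ∷ S ⟧ ρ ≡ x ^ ⟦ a ⟧ˡ ρ ++ y ∷ ⟦ S ⟧ ρ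
    ⟦∷⟧ S (_ , _ , refl) = refl

  ⟦∷ʳ0⟧ : ∀ ρ a as → ⟦ a ∷ as ⟧ ρ ++ [ y ] ≡ ⟦ a ∷ as ∷ʳ # 0 ⟧ ρ
  ⟦∷ʳ0⟧ ρ a as = trans (sym (runsL-∷ʳ (map (λ a → ⟦ a ⟧ˡ ρ) (a ∷ as)) 0 (λ ())))
                       (cong runsL (sym (map-++ (λ a → ⟦ a ⟧ˡ ρ) (a ∷ as) [ # 0 ])))

  ⟦incHead⟧ : ∀ ρ S → x ∷ ⟦ S ⟧ ρ ≡ ⟦ incHead S ⟧ ρ
  ⟦incHead⟧ ρ []       = refl
  ⟦incHead⟧ ρ (a ∷ as) = trans (x∷runs (⟦ a ⟧ˡ ρ) (map (λ a → ⟦ a ⟧ˡ ρ) as))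
                               (cong (λ n → runs n (map (λ a → ⟦ a ⟧ˡ ρ) as)) (sym (⟦incˡ⟧ a ρ)))

  -- A step adds one letter to a word and names the palindrome this creates.
  data Step : Set where
    appendX appendY prependX : List Lin → Step

  after : Step → List Lin → List Lin
  after (appendX _)  S = incLast S
  after (appendY _)  S = S ∷ʳ # 0
  after (prependX _) S = incHead S

  afterAll : List Step → List Lin → List Lin
  afterAll []         S = S
  afterAll (st ∷ sts) S = afterAll sts (after st S)

  palindromeOf : Step → List Lin
  palindromeOf (appendX P)  = P
  palindromeOf (appendY P)  = P
  palindromeOf (prependX P) = P

  Validᵇ : List Lin → List Step → Bool
  Validᵇ S []         = true
  Validᵇ S (st ∷ sts) = NewPalindromeᵇ (after st S) S (palindromeOf st) ∧ Validᵇ (after st S) sts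

  full-step : ∀ ρ S st → T (NewPalindromeᵇ (after st S) S (palindromeOf st)) →
              Full (⟦ S ⟧ ρ) → Full (⟦ after st S ⟧ ρ)
  full-step ρ S st h full with NewPalindromeᵇ-sound ρ (after st S) S (palindromeOf st) h
  full-step ρ S (appendX P) h full | pf , ¬f =
    subst Full (⟦incLast⟧ ρ S) (full-∷ʳ full (subst (λ w → PalFactor w (⟦ P ⟧ ρ)) (sym (⟦incLast⟧ ρ S)) pf) ¬f)
  full-step ρ (a ∷ as) (appendY P) h full | pf , ¬f =
    subst Full (⟦∷ʳ0⟧ ρ a as) (full-∷ʳ full (subst (λ w → PalFactor w (⟦ P ⟧ ρ)) (sym (⟦∷ʳ0⟧ ρ a as)) pf) ¬f)
  full-step ρ S (prependX P) h full | pf , ¬f =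
    subst Full (⟦incHead⟧ ρ S) (full-∷ full (subst (λ w → PalFactor w (⟦ P ⟧ ρ)) (sym (⟦incHead⟧ ρ S)) pf) ¬f)

  grow : ∀ ρ S sts → T (Validᵇ S sts) → Full (⟦ S ⟧ ρ) → Full (⟦ afterAll sts S ⟧ ρ)
  grow ρ S []         _ full = full
  grow ρ S (st ∷ sts) h full with Equivalence.to (T-∧ {NewPalindromeᵇ (after st S) S (palindromeOf st)}) h
  ... | h₁ , h₂ = grow ρ (after st S) sts h₂ (full-step ρ S st h₁ full)

-- Rich families

-- Prepending x to x^s y^p x^d ⋯ creates x^(s+1) y^p x^(s+1) while s < d, and x^(s+1) once the
-- leading run is a longest one.
module Families (x y : Letter) (x≢y : x ≢ y) where
  open Runs x y x≢y
  open Symbolic x y x≢y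

  full-yx^yx^ : ∀ c t → Full (runs 0 (c ∷ t ∷ []))
  full-yx^yx^ c zero = grow (c ∷ []) (# 0 ∷ ρ₀+ 0 ∷ []) (appendY (# 0 ∷ ρ₀+ 0 ∷ # 0 ∷ []) ∷ []) _ (full-y^x^ 1 c)
  full-yx^yx^ c (suc t) with below-or-above t c
  ... | inj₁ (m , refl) = grow (t ∷ m ∷ []) (# 0 ∷ ρ₀₁+ 1 ∷ ρ₀+ 0 ∷ [])
                            (appendX (ρ₀+ 1 ∷ ρ₀+ 1 ∷ []) ∷ []) _ (full-yx^yx^ (suc (t + m)) t)
  ... | inj₂ c≤t with m≤n⇒∃[o]m+o≡n c≤t
  ...   | m , refl = grow (c ∷ m ∷ []) (# 0 ∷ ρ₀+ 0 ∷ ρ₀₁+ 0 ∷ []) (appendX (ρ₀₁+ 1 ∷ []) ∷ []) _ (full-yx^yx^ c (c + m))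

  prepend-x^yx^yx^ : ∀ s c k → Full (runs s (c ∷ k ∷ [])) → Full (runs (suc s) (c ∷ k ∷ []))
  prepend-x^yx^yx^ s c k full with below-or-above s k
  ... | inj₁ (m , refl) = grow (s ∷ m ∷ c ∷ []) (ρ₀+ 0 ∷ ρ₂+ 0 ∷ ρ₀₁+ 1 ∷ [])
                            (prependX (ρ₀+ 1 ∷ ρ₂+ 0 ∷ ρ₀+ 1 ∷ []) ∷ []) _ full
  ... | inj₂ k≤s with below-or-above s c
  ...   | inj₂ c≤s        = full-x∷-longest-run s (c ∷ k ∷ []) (c≤s ∷ k≤s ∷ []) full
  ...   | inj₁ (m₂ , refl) with m≤n⇒∃[o]m+o≡n k≤s
  ...     | m₁ , refl = grow (k ∷ m₁ ∷ m₂ ∷ []) (ρ₀₁+ 0 ∷ ρ₀₁₂+ 1 ∷ ρ₀+ 0 ∷ [])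
                          (prependX (ρ₀₁+ 1 ∷ ρ₀₁+ 1 ∷ []) ∷ []) _ full

  full-x^yx^yx^ : ∀ s c k → Full (runs s (c ∷ k ∷ []))
  full-x^yx^yx^ zero    c k = full-yx^yx^ c k
  full-x^yx^yx^ (suc s) c k = prepend-x^yx^yx^ s c k (full-x^yx^yx^ s c k)

  prepend-x^yyyyx^ : ∀ s d → Full (runs s (0 ∷ 0 ∷ 0 ∷ d ∷ [])) → Full (runs (suc s) (0 ∷ 0 ∷ 0 ∷ d ∷ []))
  prepend-x^yyyyx^ s d full with below-or-above s d
  ... | inj₁ (k , refl) = grow (s ∷ k ∷ []) (ρ₀+ 0 ∷ # 0 ∷ # 0 ∷ # 0 ∷ ρ₀₁+ 1 ∷ [])
                            (prependX (ρ₀+ 1 ∷ # 0 ∷ # 0 ∷ # 0 ∷ ρ₀+ 1 ∷ []) ∷ []) _ full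
  ... | inj₂ d≤s        = full-x∷-longest-run s _ (z≤n ∷ z≤n ∷ z≤n ∷ d≤s ∷ []) full

  full-x^yyyyx^ : ∀ s d → Full (runs s (0 ∷ 0 ∷ 0 ∷ d ∷ []))
  full-x^yyyyx^ zero    d = full-y^x^ 4 d
  full-x^yyyyx^ (suc s) d = prepend-x^yyyyx^ s d (full-x^yyyyx^ s d)

  full-yx^yxyy : ∀ c → Full (runs 0 (suc c ∷ 1 ∷ 0 ∷ 0 ∷ []))
  full-yx^yxyy zero    = grow [] (# 0 ∷ # 1 ∷ [])
    ( appendY (# 0 ∷ # 1 ∷ # 0 ∷ [])
    ∷ appendX (# 1 ∷ # 1 ∷ [])
    ∷ appendY (# 0 ∷ # 1 ∷ # 1 ∷ # 0 ∷ [])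
    ∷ appendY (# 0 ∷ # 0 ∷ # 0 ∷ [])
    ∷ []) _ (full-y^x^ 1 1)
  full-yx^yxyy (suc c) = grow (c ∷ []) (# 0 ∷ ρ₀+ 2 ∷ [])
    ( appendY (# 0 ∷ ρ₀+ 2 ∷ # 0 ∷ [])
    ∷ appendX (# 1 ∷ # 1 ∷ [])
    ∷ appendY (# 0 ∷ # 1 ∷ # 0 ∷ [])
    ∷ appendY (# 0 ∷ # 0 ∷ # 0 ∷ [])
    ∷ []) _ (full-y^x^ 1 (suc (suc c)))

  prepend-x^yx^yxyy : ∀ s c → Full (runs s (suc c ∷ 1 ∷ 0 ∷ 0 ∷ [])) → Full (runs (suc s) (suc c ∷ 1 ∷ 0 ∷ 0 ∷ []))
  -- x y x already occurs further right, so the new palindrome reaches past the second y.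
  prepend-x^yx^yxyy zero    c full = grow (c ∷ []) (# 0 ∷ ρ₀+ 1 ∷ # 1 ∷ # 0 ∷ # 0 ∷ [])
    (prependX (# 1 ∷ ρ₀+ 1 ∷ # 1 ∷ []) ∷ []) _ full
  prepend-x^yx^yxyy (suc s) c full with below-or-above s c
  ... | inj₁ (k , refl) = grow (s ∷ k ∷ []) (ρ₀+ 1 ∷ ρ₀₁+ 2 ∷ # 1 ∷ # 0 ∷ # 0 ∷ [])
                            (prependX (ρ₀+ 2 ∷ ρ₀+ 2 ∷ []) ∷ []) _ full
  ... | inj₂ c≤s        = full-x∷-longest-run (suc s) _ (s≤s c≤s ∷ s≤s z≤n ∷ z≤n ∷ z≤n ∷ []) full

  full-x^yx^yxyy : ∀ s c → Full (runs s (suc c ∷ 1 ∷ 0 ∷ 0 ∷ []))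
  full-x^yx^yxyy zero    c = full-yx^yxyy c
  full-x^yx^yxyy (suc s) c = prepend-x^yx^yxyy s c (full-x^yx^yxyy s c)

  full-yx^yyxy : ∀ c → Full (runs 0 (suc c ∷ 0 ∷ 1 ∷ 0 ∷ []))
  full-yx^yyxy zero    = grow [] (# 0 ∷ # 1 ∷ [])
    ( appendY (# 0 ∷ # 1 ∷ # 0 ∷ [])
    ∷ appendY (# 0 ∷ # 0 ∷ # 0 ∷ [])
    ∷ appendX (# 1 ∷ # 0 ∷ # 1 ∷ [])
    ∷ appendY (# 0 ∷ # 1 ∷ # 0 ∷ # 1 ∷ # 0 ∷ [])
    ∷ []) _ (full-y^x^ 1 1)
  full-yx^yyxy (suc c) = grow (c ∷ []) (# 0 ∷ ρ₀+ 2 ∷ [])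
    ( appendY (# 0 ∷ ρ₀+ 2 ∷ # 0 ∷ [])
    ∷ appendY (# 0 ∷ # 0 ∷ # 0 ∷ [])
    ∷ appendX (# 1 ∷ # 0 ∷ # 1 ∷ [])
    ∷ appendY (# 0 ∷ # 1 ∷ # 0 ∷ [])
    ∷ []) _ (full-y^x^ 1 (suc (suc c)))

  prepend-x^yx^yyxy : ∀ s c → Full (runs s (suc c ∷ 0 ∷ 1 ∷ 0 ∷ [])) → Full (runs (suc s) (suc c ∷ 0 ∷ 1 ∷ 0 ∷ []))
  prepend-x^yx^yyxy s c full with below-or-above s (suc c)
  ... | inj₁ (k , refl) = grow (s ∷ k ∷ []) (ρ₀+ 0 ∷ ρ₀₁+ 1 ∷ # 0 ∷ # 1 ∷ # 0 ∷ [])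
                            (prependX (ρ₀+ 1 ∷ ρ₀+ 1 ∷ []) ∷ []) _ full
  ... | inj₂ c<s        = full-x∷-longest-run s _ (c<s ∷ z≤n ∷ ≤-trans (s≤s z≤n) c<s ∷ z≤n ∷ []) full

  full-x^yx^yyxy : ∀ s c → Full (runs s (suc c ∷ 0 ∷ 1 ∷ 0 ∷ []))
  full-x^yx^yyxy zero    c = full-yx^yyxy c
  full-x^yx^yyxy (suc s) c = prepend-x^yx^yyxy s c (full-x^yx^yyxy s c)

  full-yx^yyyx : ∀ c → Full (runs 0 (suc c ∷ 0 ∷ 0 ∷ 1 ∷ []))
  full-yx^yyyx zero    = grow [] (# 0 ∷ # 1 ∷ [])
    ( appendY (# 0 ∷ # 1 ∷ # 0 ∷ [])
    ∷ appendY (# 0 ∷ # 0 ∷ # 0 ∷ [])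
    ∷ appendY (# 0 ∷ # 0 ∷ # 0 ∷ # 0 ∷ [])
    ∷ appendX (# 1 ∷ # 0 ∷ # 0 ∷ # 1 ∷ [])
    ∷ []) _ (full-y^x^ 1 1)
  full-yx^yyyx (suc c) = grow (c ∷ []) (# 0 ∷ ρ₀+ 2 ∷ [])
    ( appendY (# 0 ∷ ρ₀+ 2 ∷ # 0 ∷ [])
    ∷ appendY (# 0 ∷ # 0 ∷ # 0 ∷ [])
    ∷ appendY (# 0 ∷ # 0 ∷ # 0 ∷ # 0 ∷ [])
    ∷ appendX (# 1 ∷ # 0 ∷ # 0 ∷ # 1 ∷ [])
    ∷ []) _ (full-y^x^ 1 (suc (suc c)))

  prepend-x^yx^yyyx : ∀ s c → Full (runs s (suc c ∷ 0 ∷ 0 ∷ 1 ∷ [])) → Full (runs (suc s) (suc c ∷ 0 ∷ 0 ∷ 1 ∷ []))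
  prepend-x^yx^yyyx s c full with below-or-above s (suc c)
  ... | inj₁ (k , refl) = grow (s ∷ k ∷ []) (ρ₀+ 0 ∷ ρ₀₁+ 1 ∷ # 0 ∷ # 0 ∷ # 1 ∷ [])
                            (prependX (ρ₀+ 1 ∷ ρ₀+ 1 ∷ []) ∷ []) _ full
  ... | inj₂ c<s        = full-x∷-longest-run s _ (c<s ∷ z≤n ∷ z≤n ∷ ≤-trans (s≤s z≤n) c<s ∷ []) full

  full-x^yx^yyyx : ∀ s c → Full (runs s (suc c ∷ 0 ∷ 0 ∷ 1 ∷ []))
  full-x^yx^yyyx zero    c = full-yx^yyyx c
  full-x^yx^yyyx (suc s) c = prepend-x^yx^yyyx s c (full-x^yx^yyyx s c)

  full-yyx^yxy : ∀ c → Full (runs 0 (0 ∷ suc c ∷ 1 ∷ 0 ∷ []))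
  full-yyx^yxy zero    = grow [] (# 0 ∷ # 0 ∷ # 1 ∷ [])
    ( appendY (# 0 ∷ # 1 ∷ # 0 ∷ [])
    ∷ appendX (# 1 ∷ # 1 ∷ [])
    ∷ appendY (# 0 ∷ # 1 ∷ # 1 ∷ # 0 ∷ [])
    ∷ []) _ (full-y^x^ 2 1)
  full-yyx^yxy (suc c) = grow (c ∷ []) (# 0 ∷ # 0 ∷ ρ₀+ 2 ∷ [])
    ( appendY (# 0 ∷ ρ₀+ 2 ∷ # 0 ∷ [])
    ∷ appendX (# 1 ∷ # 1 ∷ [])
    ∷ appendY (# 0 ∷ # 1 ∷ # 0 ∷ [])
    ∷ []) _ (full-y^x^ 2 (suc (suc c)))

  prepend-x^yyx^yxy : ∀ s c → Full (runs s (0 ∷ suc c ∷ 1 ∷ 0 ∷ [])) → Full (runs (suc s) (0 ∷ suc c ∷ 1 ∷ 0 ∷ []))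
  prepend-x^yyx^yxy s c full with below-or-above s (suc c)
  ... | inj₁ (k , refl) = grow (s ∷ k ∷ []) (ρ₀+ 0 ∷ # 0 ∷ ρ₀₁+ 1 ∷ # 1 ∷ # 0 ∷ [])
                            (prependX (ρ₀+ 1 ∷ # 0 ∷ ρ₀+ 1 ∷ []) ∷ []) _ full
  ... | inj₂ c<s        = full-x∷-longest-run s _ (z≤n ∷ c<s ∷ ≤-trans (s≤s z≤n) c<s ∷ z≤n ∷ []) full

  full-x^yyx^yxy : ∀ s c → Full (runs s (0 ∷ suc c ∷ 1 ∷ 0 ∷ []))
  full-x^yyx^yxy zero    c = full-yyx^yxy c
  full-x^yyx^yxy (suc s) c = prepend-x^yyx^yxy s c (full-x^yyx^yxy s c)

  full-yyx^yyx : ∀ c → Full (runs 0 (0 ∷ suc c ∷ 0 ∷ 1 ∷ []))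
  full-yyx^yyx zero    = grow [] (# 0 ∷ # 0 ∷ # 1 ∷ [])
    ( appendY (# 0 ∷ # 1 ∷ # 0 ∷ [])
    ∷ appendY (# 0 ∷ # 0 ∷ # 1 ∷ # 0 ∷ # 0 ∷ [])
    ∷ appendX (# 1 ∷ # 0 ∷ # 1 ∷ [])
    ∷ []) _ (full-y^x^ 2 1)
  full-yyx^yyx (suc c) = grow (c ∷ []) (# 0 ∷ # 0 ∷ ρ₀+ 2 ∷ [])
    ( appendY (# 0 ∷ ρ₀+ 2 ∷ # 0 ∷ [])
    ∷ appendY (# 0 ∷ # 0 ∷ ρ₀+ 2 ∷ # 0 ∷ # 0 ∷ [])
    ∷ appendX (# 1 ∷ # 0 ∷ # 1 ∷ [])
    ∷ []) _ (full-y^x^ 2 (suc (suc c)))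

  prepend-x^yyx^yyx : ∀ s c → Full (runs s (0 ∷ suc c ∷ 0 ∷ 1 ∷ [])) → Full (runs (suc s) (0 ∷ suc c ∷ 0 ∷ 1 ∷ []))
  -- x y y x already occurs further right, so the new palindrome reaches past the second y-block.
  prepend-x^yyx^yyx zero    c full = grow (c ∷ []) (# 0 ∷ # 0 ∷ ρ₀+ 1 ∷ # 0 ∷ # 1 ∷ [])
    (prependX (# 1 ∷ # 0 ∷ ρ₀+ 1 ∷ # 0 ∷ # 1 ∷ []) ∷ []) _ full
  prepend-x^yyx^yyx (suc s) c full with below-or-above s c
  ... | inj₁ (k , refl) = grow (s ∷ k ∷ []) (ρ₀+ 1 ∷ # 0 ∷ ρ₀₁+ 2 ∷ # 0 ∷ # 1 ∷ [])
                            (prependX (ρ₀+ 2 ∷ # 0 ∷ ρ₀+ 2 ∷ []) ∷ []) _ full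
  ... | inj₂ c≤s        = full-x∷-longest-run (suc s) _ (z≤n ∷ s≤s c≤s ∷ z≤n ∷ s≤s z≤n ∷ []) full

  full-x^yyx^yyx : ∀ s c → Full (runs s (0 ∷ suc c ∷ 0 ∷ 1 ∷ []))
  full-x^yyx^yyx zero    c = full-yyx^yyx c
  full-x^yyx^yyx (suc s) c = prepend-x^yyx^yyx s c (full-x^yyx^yyx s c)

  full-yyyx^yx : ∀ c → Full (runs 0 (0 ∷ 0 ∷ suc c ∷ 1 ∷ []))
  full-yyyx^yx zero    = grow [] (# 0 ∷ # 0 ∷ # 0 ∷ # 1 ∷ [])
    (appendY (# 0 ∷ # 1 ∷ # 0 ∷ []) ∷ appendX (# 1 ∷ # 1 ∷ []) ∷ []) _ (full-y^x^ 3 1)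
  full-yyyx^yx (suc c) = grow (c ∷ []) (# 0 ∷ # 0 ∷ # 0 ∷ ρ₀+ 2 ∷ [])
    (appendY (# 0 ∷ ρ₀+ 2 ∷ # 0 ∷ []) ∷ appendX (# 1 ∷ # 1 ∷ []) ∷ []) _ (full-y^x^ 3 (suc (suc c)))

  prepend-x^yyyx^yx : ∀ s c → Full (runs s (0 ∷ 0 ∷ suc c ∷ 1 ∷ [])) → Full (runs (suc s) (0 ∷ 0 ∷ suc c ∷ 1 ∷ []))
  prepend-x^yyyx^yx s c full with below-or-above s (suc c)
  ... | inj₁ (k , refl) = grow (s ∷ k ∷ []) (ρ₀+ 0 ∷ # 0 ∷ # 0 ∷ ρ₀₁+ 1 ∷ # 1 ∷ [])
                            (prependX (ρ₀+ 1 ∷ # 0 ∷ # 0 ∷ ρ₀+ 1 ∷ []) ∷ []) _ full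
  ... | inj₂ c<s        = full-x∷-longest-run s _ (z≤n ∷ z≤n ∷ c<s ∷ ≤-trans (s≤s z≤n) c<s ∷ []) full

  full-x^yyyx^yx : ∀ s c → Full (runs s (0 ∷ 0 ∷ suc c ∷ 1 ∷ []))
  full-x^yyyx^yx zero    c = full-yyyx^yx c
  full-x^yyyx^yx (suc s) c = prepend-x^yyyx^yx s c (full-x^yyyx^yx s c)

-- Block reversals

concat-reverse-∷ : ∀ (B : Word) Bs → concat (reverse (B ∷ Bs)) ≡ concat (reverse Bs) ++ B
concat-reverse-∷ B Bs = begin
  concat (reverse (B ∷ Bs))      ≡⟨ cong concat (unfold-reverse B Bs) ⟩
  concat (reverse Bs ++ [ B ])   ≡⟨ concat-++ (reverse Bs) [ B ] ⟨
  concat (reverse Bs) ++ B ++ [] ≡⟨ cong (concat (reverse Bs) ++_) (++-identityʳ B) ⟩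
  concat (reverse Bs) ++ B       ∎
  where open ≡-Reasoning

occurrences-concat-reverse : ∀ c Bs → occurrences c (concat (reverse Bs)) ≡ occurrences c (concat Bs)
occurrences-concat-reverse c []       = refl
occurrences-concat-reverse c (B ∷ Bs) = begin
  occurrences c (concat (reverse (B ∷ Bs)))           ≡⟨ cong (occurrences c) (concat-reverse-∷ B Bs) ⟩
  occurrences c (concat (reverse Bs) ++ B)            ≡⟨ occurrences-++ c (concat (reverse Bs)) B ⟩
  occurrences c (concat (reverse Bs)) + occurrences c B ≡⟨ cong (_+ occurrences c B) (occurrences-concat-reverse c Bs) ⟩
  occurrences c (concat Bs) + occurrences c B         ≡⟨ +-comm (occurrences c (concat Bs)) (occurrences c B) ⟩
  occurrences c B + occurrences c (concat Bs)         ≡⟨ occurrences-++ c B (concat Bs) ⟨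
  occurrences c (concat (B ∷ Bs))                     ∎
  where open ≡-Reasoning

InBR⇒occurrences : ∀ c {w v} → InBR w v → occurrences c v ≡ occurrences c w
InBR⇒occurrences c (Bs , _ , _ , refl , refl) = occurrences-concat-reverse c Bs

reverse-concat : ∀ (Bs : List Word) → reverse (concat Bs) ≡ concat (map reverse (reverse Bs))
reverse-concat []       = refl
reverse-concat (B ∷ Bs) = begin
  reverse (B ++ concat Bs)                          ≡⟨ reverse-++ B (concat Bs) ⟩
  reverse (concat Bs) ++ reverse B                  ≡⟨ cong (_++ reverse B) (reverse-concat Bs) ⟩
  concat (map reverse (reverse Bs)) ++ reverse B    ≡⟨ cong (λ z → concat z ++ reverse B) (reverse-map reverse Bs) ⟩
  concat (reverse (map reverse Bs)) ++ reverse B    ≡⟨ concat-reverse-∷ (reverse B) (map reverse Bs) ⟨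
  concat (reverse (map reverse (B ∷ Bs)))           ≡⟨ cong concat (reverse-map reverse (B ∷ Bs)) ⟨
  concat (map reverse (reverse (B ∷ Bs)))           ∎
  where open ≡-Reasoning

InBR-reverse : ∀ {w v} → InBR w v → InBR (reverse w) (reverse v)
InBR-reverse (Bs , 0<t , nonEmpty , refl , refl) =
  map reverse (reverse Bs) ,
  subst (0 <_) (sym (trans (length-map reverse (reverse Bs)) (length-reverse Bs))) 0<t ,
  All.map⁺ (All.tabulate (λ {B} m → subst (0 <_) (sym (length-reverse B)) (All.lookup nonEmpty (Any.reverse⁻ m)))) ,
  sym (reverse-concat Bs) ,
  trans (reverse-concat (reverse Bs)) (cong concat (reverse-map reverse (reverse Bs)))

mutual
  reversals : Word → List Word
  reversals []      = []
  reversals (a ∷ w) = reversalsFrom [ a ] w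

  -- the elements B_t ⋯ B₂ B₁ of BR(B ++ w) whose first block B₁ begins with B
  reversalsFrom : Word → Word → List Word
  reversalsFrom B []      = [ B ]
  reversalsFrom B (c ∷ w) = map (_++ B) (reversals (c ∷ w)) ++ reversalsFrom (B ∷ʳ c) w

∈-reversalsFrom-single : ∀ P B → P ++ B ∈ reversalsFrom P B
∈-reversalsFrom-single P []      = here (++-identityʳ P)
∈-reversalsFrom-single P (b ∷ B) = ∈-++⁺ʳ _
  (subst (_∈ reversalsFrom (P ∷ʳ b) B) (++-assoc P [ b ] B) (∈-reversalsFrom-single (P ∷ʳ b) B))

∈-reversalsFrom-more : ∀ P B c w {v} → v ∈ reversals (c ∷ w) → v ++ P ++ B ∈ reversalsFrom P (B ++ c ∷ w)
∈-reversalsFrom-more P []      c w {v} m = ∈-++⁺ˡ (subst (_∈ map (_++ P) (reversals (c ∷ w)))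
  (cong (v ++_) (sym (++-identityʳ P))) (∈-map⁺ (_++ P) m))
∈-reversalsFrom-more P (b ∷ B) c w {v} m = ∈-++⁺ʳ _
  (subst (_∈ reversalsFrom (P ∷ʳ b) (B ++ c ∷ w)) (cong (v ++_) (++-assoc P [ b ] B))
    (∈-reversalsFrom-more (P ∷ʳ b) B c w m))

InBR⇒∈reversals : ∀ {w v} → InBR w v → v ∈ reversals w
InBR⇒∈reversals (Bs , 0<t , nonEmpty , refl , refl) = ∈-reversals Bs 0<t nonEmpty
  where
  ∈-reversals : ∀ Bs → 0 < length Bs → All NonEmpty Bs → concat (reverse Bs) ∈ reversals (concat Bs)
  ∈-reversals ([] ∷ _)          _ (() ∷ _)
  ∈-reversals (_ ∷ [] ∷ _)      _ (_ ∷ () ∷ _)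
  ∈-reversals ((a ∷ B) ∷ []) _ _ =
    subst₂ (λ u z → u ∈ reversalsFrom [ a ] z) (sym (++-identityʳ (a ∷ B))) (sym (++-identityʳ B))
      (∈-reversalsFrom-single [ a ] B)
  ∈-reversals ((a ∷ B) ∷ (c ∷ C) ∷ Bs) _ (_ ∷ nonEmpty) =
    subst (_∈ reversalsFrom [ a ] (B ++ c ∷ C ++ concat Bs)) (sym (concat-reverse-∷ (a ∷ B) ((c ∷ C) ∷ Bs)))
      (∈-reversalsFrom-more [ a ] B c (C ++ concat Bs) (∈-reversals ((c ∷ C) ∷ Bs) (s≤s z≤n) nonEmpty))

BR-x²y⁴x²-full : ∀ {x y} → x ≢ y → All Full (reversals (x ^ 2 ++ y ^ 4 ++ x ^ 2))
BR-x²y⁴x²-full = by-distinct-letters {P = λ x y → All Full (reversals (x ^ 2 ++ y ^ 4 ++ x ^ 2))}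
  (toWitness {a? = all? full? _} _) (toWitness {a? = all? full? _} _)

AllFullBR : Word → Set
AllFullBR w = ∀ v → InBR w v → Full v

AllFullBR-reverse : ∀ w → AllFullBR w → AllFullBR (reverse w)
AllFullBR-reverse w all-full v br = subst Full (reverse-involutive v) (full-reverse (reverse v)
  (all-full (reverse v) (subst (λ z → InBR z (reverse v)) (reverse-involutive w) (InBR-reverse br))))

AllFullBR-mirror : ∀ (x y : Letter) i j k → AllFullBR (x ^ i ++ y ^ j ++ x ^ k) → AllFullBR (x ^ k ++ y ^ j ++ x ^ i)
AllFullBR-mirror x y i j k = subst AllFullBR (reverse-x^y^x^ x y i j k) ∘′ AllFullBR-reverse _

concat-reverse-^ : ∀ (c : Letter) Bs m → concat Bs ≡ c ^ m → concat (reverse Bs) ≡ c ^ m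
concat-reverse-^ c []       m e = e
concat-reverse-^ c (B ∷ Bs) m e with ++≡^ c B (concat Bs) m e
... | j , j′ , refl , q , refl = begin
  concat (reverse (B ∷ Bs)) ≡⟨ concat-reverse-∷ B Bs ⟩
  concat (reverse Bs) ++ B  ≡⟨ cong (_++ B) (concat-reverse-^ c Bs j′ q) ⟩
  c ^ j′ ++ c ^ j           ≡⟨ ^-+ c j′ j ⟨
  c ^ (j′ + j)              ≡⟨ cong (c ^_) (+-comm j′ j) ⟩
  c ^ (j + j′)              ∎
  where open ≡-Reasoning

module _ (x y : Letter) where

  BR-y^x^ : ∀ Bs k m → All NonEmpty Bs → concat Bs ≡ y ^ suc k ++ x ^ m →
    ∃[ e ] ∃[ p ] ∃[ c ] ∃[ q ] (concat (reverse Bs) ≡ x ^ e ++ y ^ p ++ x ^ c ++ y ^ q × 1 ≤ p × p + q ≡ suc k)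
  BR-y^x^ (B ∷ Bs) k m (_ ∷ nonEmpty) e with ++≡^++^ x y B (concat Bs) (suc k) m e
  ... | inj₁ (r , zero , refl , rest , r+0≡) =
    m , r , 0 , 0 , (begin
      concat (reverse (y ^ r ∷ Bs))     ≡⟨ concat-reverse-∷ (y ^ r) Bs ⟩
      concat (reverse Bs) ++ y ^ r      ≡⟨ cong (_++ y ^ r) (concat-reverse-^ x Bs m rest) ⟩
      x ^ m ++ y ^ r                    ≡⟨ cong (x ^ m ++_) (++-identityʳ (y ^ r)) ⟨
      x ^ m ++ y ^ r ++ []              ∎) ,
    subst (1 ≤_) (trans (sym r+0≡) (+-identityʳ r)) (s≤s z≤n) , r+0≡
    where open ≡-Reasoning
  ... | inj₂ (j , j′ , refl , rest , _) =
    j′ , suc k , j , 0 , (begin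
      concat (reverse ((y ^ suc k ++ x ^ j) ∷ Bs))  ≡⟨ concat-reverse-∷ (y ^ suc k ++ x ^ j) Bs ⟩
      concat (reverse Bs) ++ y ^ suc k ++ x ^ j     ≡⟨ cong (_++ y ^ suc k ++ x ^ j) (concat-reverse-^ x Bs j′ rest) ⟩
      x ^ j′ ++ y ^ suc k ++ x ^ j                  ≡⟨ cong (λ z → x ^ j′ ++ y ^ suc k ++ z) (++-identityʳ (x ^ j)) ⟨
      x ^ j′ ++ y ^ suc k ++ x ^ j ++ []            ∎) ,
    s≤s z≤n , +-identityʳ (suc k)
    where open ≡-Reasoning
  ... | inj₁ (r , suc r′ , refl , rest , r+r′≡) with BR-y^x^ Bs r′ m nonEmpty rest
  ...   | e′ , p , c , q , eq , 1≤p , p+q≡ =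
    e′ , p , c , q + r , (begin
      concat (reverse (y ^ r ∷ Bs))                  ≡⟨ concat-reverse-∷ (y ^ r) Bs ⟩
      concat (reverse Bs) ++ y ^ r                   ≡⟨ cong (_++ y ^ r) eq ⟩
      (x ^ e′ ++ y ^ p ++ x ^ c ++ y ^ q) ++ y ^ r   ≡⟨ ++-assoc₄ (x ^ e′) (y ^ p) (x ^ c) (y ^ q) (y ^ r) ⟩
      x ^ e′ ++ y ^ p ++ x ^ c ++ y ^ q ++ y ^ r     ≡⟨ cong (λ z → x ^ e′ ++ y ^ p ++ x ^ c ++ z) (^-+ y q r) ⟨
      x ^ e′ ++ y ^ p ++ x ^ c ++ y ^ (q + r)        ∎) ,
    1≤p , (begin
      p + (q + r)   ≡⟨ +-assoc p q r ⟨
      p + q + r     ≡⟨ cong (_+ r) p+q≡ ⟩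
      suc r′ + r    ≡⟨ +-comm (suc r′) r ⟩
      r + suc r′    ≡⟨ r+r′≡ ⟩
      suc k         ∎)
    where open ≡-Reasoning

  BR-xy^x^ : ∀ Bs n m → All NonEmpty Bs → concat Bs ≡ x ∷ y ^ n ++ x ^ m →
    ∃[ e ] ∃[ p ] ∃[ c ] ∃[ q ] ∃[ r ]
      (concat (reverse Bs) ≡ x ^ e ++ y ^ p ++ x ^ c ++ y ^ q ++ x ∷ y ^ r × 1 ≤ p × p + q + r ≡ n) ⊎
    ∃[ e ] ∃[ c ] (concat (reverse Bs) ≡ x ^ e ++ x ∷ y ^ n ++ x ^ c)
  BR-xy^x^ ((b ∷ B) ∷ Bs) n m (_ ∷ nonEmpty) e with ∷-injective e
  ... | refl , e′ with ++≡^++^ x y B (concat Bs) n m e′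
  ... | inj₁ (r , zero , refl , rest , r+0≡n) = inj₂ (m , 0 , (begin
    concat (reverse ((x ∷ y ^ r) ∷ Bs))  ≡⟨ concat-reverse-∷ (x ∷ y ^ r) Bs ⟩
    concat (reverse Bs) ++ x ∷ y ^ r     ≡⟨ cong (_++ x ∷ y ^ r) (concat-reverse-^ x Bs m rest) ⟩
    x ^ m ++ x ∷ y ^ r                   ≡⟨ cong (λ k → x ^ m ++ x ∷ y ^ k) (trans (sym (+-identityʳ r)) r+0≡n) ⟩
    x ^ m ++ x ∷ y ^ n                   ≡⟨ cong (λ z → x ^ m ++ x ∷ z) (++-identityʳ (y ^ n)) ⟨
    x ^ m ++ x ∷ y ^ n ++ []             ∎))
    where open ≡-Reasoning
  ... | inj₂ (j , j′ , refl , rest , _) = inj₂ (j′ , j ,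
    trans (concat-reverse-∷ (x ∷ y ^ n ++ x ^ j) Bs) (cong (_++ x ∷ y ^ n ++ x ^ j) (concat-reverse-^ x Bs j′ rest)))
  ... | inj₁ (r , suc r′ , refl , rest , r+r′≡n) with BR-y^x^ Bs r′ m nonEmpty rest
  ...   | e″ , p , c , q , eq , 1≤p , p+q≡ = inj₁ (e″ , p , c , q , r , (begin
    concat (reverse ((x ∷ y ^ r) ∷ Bs))                   ≡⟨ concat-reverse-∷ (x ∷ y ^ r) Bs ⟩
    concat (reverse Bs) ++ x ∷ y ^ r                      ≡⟨ cong (_++ x ∷ y ^ r) eq ⟩
    (x ^ e″ ++ y ^ p ++ x ^ c ++ y ^ q) ++ x ∷ y ^ r      ≡⟨ ++-assoc₄ (x ^ e″) (y ^ p) (x ^ c) (y ^ q) (x ∷ y ^ r) ⟩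
    x ^ e″ ++ y ^ p ++ x ^ c ++ y ^ q ++ x ∷ y ^ r        ∎) ,
    1≤p , trans (cong (_+ r) p+q≡) (trans (+-comm (suc r′) r) r+r′≡n))
    where open ≡-Reasoning

-- Sufficiency

module Shapes (x y : Letter) (x≢y : x ≢ y) where
  open Runs x y x≢y
  open Families x y x≢y

  x^y∷ : ∀ e v s → (x ^ e ++ y ∷ v) ++ s ≡ x ^ e ++ y ∷ v ++ s
  x^y∷ e v s = ++-assoc (x ^ e) (y ∷ v) s

  full-x^y^x^y^xy^ : ∀ e p c q r → 1 ≤ p → p + q + r ≡ 4 → Full (x ^ e ++ y ^ p ++ x ^ c ++ y ^ q ++ x ∷ y ^ r)
  full-x^y^x^y^xy^ e 1 c 0 3 _ refl = full-prefix [ x ]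
    (trans (x^y∷ e _ [ x ]) (cong (λ v → x ^ e ++ y ∷ v) (trans (++-assoc (x ^ c) _ [ x ]) (^-++-∷ x c _))))
    (full-x^yx^yyyx e c)
  full-x^y^x^y^xy^ e 1 zero    1 2 _ refl = full-prefix [ x ] (x^y∷ e _ [ x ]) (full-x^yyx^yyx e 0)
  full-x^y^x^y^xy^ e 1 (suc c) 1 2 _ refl = full-x^yx^yxyy e c
  full-x^y^x^y^xy^ e 1 zero    2 1 _ refl = full-prefix [ x ] (x^y∷ e _ [ x ]) (full-x^yyyx^yx e 0)
  full-x^y^x^y^xy^ e 1 (suc c) 2 1 _ refl = full-x^yx^yyxy e c
  full-x^y^x^y^xy^ e 1 zero    3 0 _ refl = full-x^yyyyx^ e 1
  full-x^y^x^y^xy^ e 1 (suc c) 3 0 _ refl = full-x^yx^yyyx e c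
  full-x^y^x^y^xy^ e 2 c 0 2 _ refl = full-prefix [ x ]
    (trans (x^y∷ e _ [ x ]) (cong (λ v → x ^ e ++ y ∷ y ∷ v) (trans (++-assoc (x ^ c) _ [ x ]) (^-++-∷ x c _))))
    (full-x^yyx^yyx e c)
  full-x^y^x^y^xy^ e 2 zero    1 1 _ refl = full-prefix [ x ] (x^y∷ e _ [ x ]) (full-x^yyyx^yx e 0)
  full-x^y^x^y^xy^ e 2 (suc c) 1 1 _ refl = full-x^yyx^yxy e c
  full-x^y^x^y^xy^ e 2 zero    2 0 _ refl = full-x^yyyyx^ e 1
  full-x^y^x^y^xy^ e 2 (suc c) 2 0 _ refl = full-x^yyx^yyx e c
  full-x^y^x^y^xy^ e 3 c 0 1 _ refl = full-prefix [ x ]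
    (trans (x^y∷ e _ [ x ]) (cong (λ v → x ^ e ++ y ∷ y ∷ y ∷ v) (trans (++-assoc (x ^ c) _ [ x ]) (^-++-∷ x c _))))
    (full-x^yyyx^yx e c)
  full-x^y^x^y^xy^ e 3 zero    1 0 _ refl = full-x^yyyyx^ e 1
  full-x^y^x^y^xy^ e 3 (suc c) 1 0 _ refl = full-x^yyyx^yx e c
  full-x^y^x^y^xy^ e 4 c 0 0 _ refl =
    subst Full (cong (λ v → x ^ e ++ y ∷ y ∷ y ∷ y ∷ v) (sym (trans (^-++-∷ x c []) (cong (x ∷_) (++-identityʳ (x ^ c))))))
      (full-x^yyyyx^ e (suc c))

  full-x^y^x^y^xy^-sum3 : ∀ e p c q r → 1 ≤ p → p + q + r ≡ 3 → Full (x ^ e ++ y ^ p ++ x ^ c ++ y ^ q ++ x ∷ y ^ r)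
  full-x^y^x^y^xy^-sum3 e p c q r 1≤p sum≡3 = full-prefix [ y ] extend
    (full-x^y^x^y^xy^ e p c q (suc r) 1≤p (trans (+-suc (p + q) r) (cong suc sum≡3)))
    where
    open ≡-Reasoning
    extend : (x ^ e ++ y ^ p ++ x ^ c ++ y ^ q ++ x ∷ y ^ r) ++ [ y ] ≡ x ^ e ++ y ^ p ++ x ^ c ++ y ^ q ++ x ∷ y ^ suc r
    extend = begin
      (x ^ e ++ y ^ p ++ x ^ c ++ y ^ q ++ x ∷ y ^ r) ++ [ y ]   ≡⟨ ++-assoc₄ (x ^ e) (y ^ p) (x ^ c) _ [ y ] ⟩
      x ^ e ++ y ^ p ++ x ^ c ++ (y ^ q ++ x ∷ y ^ r) ++ [ y ]   ≡⟨ cong (λ z → x ^ e ++ y ^ p ++ x ^ c ++ z) (++-assoc (y ^ q) _ [ y ]) ⟩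
      x ^ e ++ y ^ p ++ x ^ c ++ y ^ q ++ x ∷ y ^ r ++ [ y ]     ≡⟨ cong (λ z → x ^ e ++ y ^ p ++ x ^ c ++ y ^ q ++ x ∷ z) (^-∷ʳ y r) ⟩
      x ^ e ++ y ^ p ++ x ^ c ++ y ^ q ++ x ∷ y ^ suc r         ∎

  BR-xy^x^-full : ∀ n m {v} → n ≡ 3 ⊎ n ≡ 4 → InBR (x ∷ y ^ n ++ x ^ m) v → Full v
  BR-xy^x^-full n m n∈ (Bs , _ , nonEmpty , w≡ , refl) with BR-xy^x^ x y Bs n m nonEmpty w≡ | n∈
  ... | inj₁ (e , p , c , q , r , v≡ , 1≤p , sum) | inj₁ refl = subst Full (sym v≡) (full-x^y^x^y^xy^-sum3 e p c q r 1≤p sum)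
  ... | inj₁ (e , p , c , q , r , v≡ , 1≤p , sum) | inj₂ refl = subst Full (sym v≡) (full-x^y^x^y^xy^ e p c q r 1≤p sum)
  ... | inj₂ (e , c , v≡) | inj₂ refl = subst Full (sym (trans v≡ (^-++-∷ x e _))) (full-x^yyyyx^ (suc e) c)
  ... | inj₂ (e , zero , v≡) | inj₁ refl = subst Full (sym (trans v≡ (^-++-∷ x e _)))
    (full-prefix [ y ] (cong (x ∷_) (x^y∷ e (y ∷ y ∷ []) [ y ])) (full-x^yyyyx^ (suc e) 0))
  ... | inj₂ (e , suc c , v≡) | inj₁ refl = subst Full (sym (trans v≡ (^-++-∷ x e _)))
    (full-prefix (y ∷ x ∷ []) (cong (x ∷_) (x^y∷ e _ _)) (full-x^yyyx^yx (suc e) c))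

  occurrences-y-x^ : ∀ m u k → occurrences y (x ^ m ++ u ++ x ^ k) ≡ occurrences y u
  occurrences-y-x^ m u k = begin
    occurrences y (x ^ m ++ u ++ x ^ k)                       ≡⟨ occurrences-++ y (x ^ m) _ ⟩
    occurrences y (x ^ m) + occurrences y (u ++ x ^ k)        ≡⟨ cong₂ _+_ (occurrences-^-≢ y≢x m) (occurrences-++ y u (x ^ k)) ⟩
    occurrences y u + occurrences y (x ^ k)                   ≡⟨ cong (occurrences y u +_) (occurrences-^-≢ y≢x k) ⟩
    occurrences y u + 0                                       ≡⟨ +-identityʳ _ ⟩
    occurrences y u                                           ∎
    where
    open ≡-Reasoning
    y≢x : y ≢ x
    y≢x y≡x = x≢y (sym y≡x)

  occurrences-x-xy^x : ∀ m → occurrences x (x ∷ y ^ m ++ [ x ]) ≡ 2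
  occurrences-x-xy^x m = begin
    occurrences x (x ∷ y ^ m ++ [ x ])                ≡⟨ cong length (filter-accept (x ≟ᵇ_) {x} {y ^ m ++ [ x ]} refl) ⟩
    suc (occurrences x (y ^ m ++ [ x ]))              ≡⟨ cong suc (occurrences-++ x (y ^ m) [ x ]) ⟩
    suc (occurrences x (y ^ m) + occurrences x [ x ]) ≡⟨ cong (λ n → suc (n + occurrences x [ x ])) (occurrences-^-≢ x≢y m) ⟩
    suc (occurrences x (x ^ 1))                       ≡⟨ cong suc (occurrences-^ x 1) ⟩
    2                                                 ∎
    where open ≡-Reasoning

  runs-decomposition : ∀ w → ∃[ a ] ∃[ as ] (w ≡ runs a as × length as ≡ occurrences y w)
  runs-decomposition []      = 0 , [] , refl , refl
  runs-decomposition (c ∷ w) with runs-decomposition w | x-or-y x≢y c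
  ... | a , as , refl , len | inj₁ refl = suc a , as , x∷runs a as ,
    trans len (sym (cong length (filter-reject (y ≟ᵇ_) {x} {runs a as} (λ y≡x → x≢y (sym y≡x)))))
  ... | a , as , refl , len | inj₂ refl = 0 , a ∷ as , refl ,
    trans (cong suc len) (sym (cong length (filter-accept (y ≟ᵇ_) {y} {runs a as} refl)))

  full-two-y : ∀ w → occurrences y w ≡ 2 → Full w
  full-two-y w two with runs-decomposition w
  ... | a , c ∷ k ∷ [] , refl , _ = full-x^yx^yx^ a c k
  ... | a , []             , refl , len with () ← trans len two
  ... | a , _ ∷ []         , refl , len with () ← trans len two
  ... | a , _ ∷ _ ∷ _ ∷ _ , refl , len with () ← trans len two

  full-one-y : ∀ w → occurrences y w ≡ 1 → Full w
  full-one-y w one with runs-decomposition w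
  ... | a , d ∷ [] , refl , _ = full-prefix [ y ] (x^y∷ a (x ^ d) [ y ]) (full-x^yx^yx^ a d 0)
  ... | a , []          , refl , len with () ← trans len one
  ... | a , _ ∷ _ ∷ _  , refl , len with () ← trans len one

forms⇒AllFullBR : ∀ w → Forms w → AllFullBR w
forms⇒AllFullBR w (x , y , x≢y , form) v br with form
... | inj₁ refl = All.lookup (BR-x²y⁴x²-full x≢y) (InBR⇒∈reversals br)
... | inj₂ (inj₁ (m , _ , refl)) = Shapes.full-two-y y x (λ y≡x → x≢y (sym y≡x)) v
      (trans (InBR⇒occurrences x br) (Shapes.occurrences-x-xy^x x y x≢y m))
... | inj₂ (inj₂ (inj₁ (m₁ , m₃ , _ , _ , refl))) = Shapes.full-one-y x y x≢y v
      (trans (InBR⇒occurrences y br) (trans (Shapes.occurrences-y-x^ x y x≢y m₁ [ y ] m₃) (occurrences-^ y 1)))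
... | inj₂ (inj₂ (inj₂ (inj₁ (m₁ , m₃ , _ , _ , refl)))) = Shapes.full-two-y x y x≢y v
      (trans (InBR⇒occurrences y br) (trans (Shapes.occurrences-y-x^ x y x≢y m₁ (y ^ 2) m₃) (occurrences-^ y 2)))
... | inj₂ (inj₂ (inj₂ (inj₂ (inj₁ (n₂ , n₃ , n₂∈ , _ , refl))))) = Shapes.BR-xy^x^-full x y x≢y n₂ n₃ n₂∈ br
... | inj₂ (inj₂ (inj₂ (inj₂ (inj₂ (n₁ , n₂ , n₂∈ , _ , refl))))) =
      AllFullBR-mirror x y 1 n₂ n₁ (λ _ → Shapes.BR-xy^x^-full x y x≢y n₂ n₁ n₂∈) v br

-- Necessity

not-AllFullBR : ∀ {w v} u → ¬ Full u → InBR w v → Factor u v → ¬ AllFullBR w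
not-AllFullBR {v = v} u ¬full br f all-full = ¬full (full-factor f (all-full v br))

module Counterexamples (x y : Letter) (x≢y : x ≢ y) where

  xxyxyyxx yyxxyxyy : Word
  xxyxyyxx = x ∷ x ∷ y ∷ x ∷ y ∷ y ∷ x ∷ x ∷ []
  yyxxyxyy = y ∷ y ∷ x ∷ x ∷ y ∷ x ∷ y ∷ y ∷ []

  xxyxyyxx-not-full : ¬ Full xxyxyyxx
  xxyxyyxx-not-full = by-distinct-letters {P = λ x y → ¬ Full (x ∷ x ∷ y ∷ x ∷ y ∷ y ∷ x ∷ x ∷ [])} (λ ()) (λ ()) x≢y

  yyxxyxyy-not-full : ¬ Full yyxxyxyy
  yyxxyxyy-not-full = by-distinct-letters {P = λ x y → ¬ Full (y ∷ y ∷ x ∷ x ∷ y ∷ x ∷ y ∷ y ∷ [])} (λ ()) (λ ()) x≢y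

  ^-++-∷∷ : ∀ (c : Letter) n w → c ^ n ++ c ∷ c ∷ w ≡ c ∷ c ∷ c ^ n ++ w
  ^-++-∷∷ c n w = trans (^-++-∷ c n _) (cong (c ∷_) (^-++-∷ c n w))

  x³⁺y³⁺x²⁺ : ∀ a b k → ¬ AllFullBR (x ^ (3 + a) ++ y ^ (3 + b) ++ x ^ (2 + k))
  x³⁺y³⁺x²⁺ a b k = not-AllFullBR xxyxyyxx xxyxyyxx-not-full
    ( x ^ (2 + a) ∷ (x ∷ y ∷ y ∷ []) ∷ [ y ] ∷ (y ^ b ++ x ^ (2 + k)) ∷ [] , s≤s z≤n
    , s≤s z≤n ∷ s≤s z≤n ∷ s≤s z≤n ∷ nonEmpty ∷ []
    , cong (λ z → x ∷ x ∷ z) (trans (^-++-∷ x a _) (cong (λ z → x ∷ x ^ a ++ y ∷ y ∷ y ∷ z) (++-identityʳ _)))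
    , refl)
    (y ^ b ++ x ^ k , x ^ a ++ [] ,
      trans (++-assoc (y ^ b) (x ^ k) _) (trans (cong (y ^ b ++_) (^-++-∷∷ x k _)) (sym (++-assoc (y ^ b) (x ∷ x ∷ x ^ k) _))))
    where
    nonEmpty : NonEmpty (y ^ b ++ x ^ (2 + k))
    nonEmpty = subst (0 <_) (sym (length-++ (y ^ b))) (≤-trans (s≤s z≤n) (m≤n+m _ (length (y ^ b))))

  -- In the reversals below the block y y y^b x x is followed by y and x y y: this exhibits y y x x y x y y.
  yy^bxx : ∀ b w → y ^ b ++ y ∷ y ∷ x ∷ x ∷ w ≡ y ∷ y ∷ (y ^ b ++ x ∷ x ∷ []) ++ w
  yy^bxx b w = trans (^-++-∷∷ y b _) (cong (λ z → y ∷ y ∷ z) (sym (++-assoc (y ^ b) (x ∷ x ∷ []) w)))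

  xy⁵⁺x² : ∀ b → ¬ AllFullBR (x ∷ y ^ (5 + b) ++ x ^ 2)
  xy⁵⁺x² b = not-AllFullBR yyxxyxyy yyxxyxyy-not-full
    ( (x ∷ y ∷ y ∷ []) ∷ [ y ] ∷ (y ∷ y ∷ y ^ b ++ x ∷ x ∷ []) ∷ [] , s≤s z≤n
    , s≤s z≤n ∷ s≤s z≤n ∷ s≤s z≤n ∷ []
    , cong (λ z → x ∷ y ∷ y ∷ y ∷ y ∷ y ∷ z) (++-identityʳ _) , refl)
    (y ^ b , [] , yy^bxx b _)

  xy⁵⁺x³⁺ : ∀ b k → ¬ AllFullBR (x ∷ y ^ (5 + b) ++ x ^ (3 + k))
  xy⁵⁺x³⁺ b k = not-AllFullBR yyxxyxyy yyxxyxyy-not-full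
    ( (x ∷ y ∷ y ∷ []) ∷ [ y ] ∷ (y ∷ y ∷ y ^ b ++ x ∷ x ∷ []) ∷ (x ∷ x ^ k) ∷ [] , s≤s z≤n
    , s≤s z≤n ∷ s≤s z≤n ∷ s≤s z≤n ∷ s≤s z≤n ∷ []
    , cong (λ z → x ∷ y ∷ y ∷ y ∷ y ∷ y ∷ z)
        (trans (++-assoc (y ^ b) _ _) (cong (λ z → y ^ b ++ x ∷ x ∷ x ∷ z) (++-identityʳ _)))
    , refl)
    (x ∷ x ^ k ++ y ^ b , [] , cong (x ∷_) (trans (++-assoc (x ^ k) (y ^ b) _) (cong (x ^ k ++_) (yy^bxx b _))))

  x²y⁵⁺x² : ∀ b → ¬ AllFullBR (x ^ 2 ++ y ^ (5 + b) ++ x ^ 2)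
  x²y⁵⁺x² b = not-AllFullBR yyxxyxyy yyxxyxyy-not-full
    ( [ x ] ∷ (x ∷ y ∷ y ∷ []) ∷ [ y ] ∷ (y ∷ y ∷ y ^ b ++ x ∷ x ∷ []) ∷ [] , s≤s z≤n
    , s≤s z≤n ∷ s≤s z≤n ∷ s≤s z≤n ∷ s≤s z≤n ∷ []
    , cong (λ z → x ∷ x ∷ y ∷ y ∷ y ∷ y ∷ y ∷ z) (++-identityʳ _) , refl)
    (y ^ b , [ x ] , yy^bxx b _)

module Classification (x y : Letter) (x≢y : x ≢ y) where
  open Counterexamples x y x≢y

  too-short : ∀ {n} → T (n ≤ᵇ 7) → ¬ 7 < n
  too-short {n} h len = <⇒≱ len (≤ᵇ⇒≤ n 7 h)

  all-full⇒forms : ∀ n₁ n₂ n₃ → 1 ≤ n₁ → 1 ≤ n₂ → 1 ≤ n₃ → 7 < n₁ + n₂ + n₃ →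
                   AllFullBR (x ^ n₁ ++ y ^ n₂ ++ x ^ n₃) → Forms (x ^ n₁ ++ y ^ n₂ ++ x ^ n₃)
  all-full⇒forms n₁ 1 n₃ 1≤n₁ _ 1≤n₃ _ _ = x , y , x≢y , inj₂ (inj₂ (inj₁ (n₁ , n₃ , 1≤n₁ , 1≤n₃ , refl)))
  all-full⇒forms n₁ 2 n₃ 1≤n₁ _ 1≤n₃ _ _ = x , y , x≢y , inj₂ (inj₂ (inj₂ (inj₁ (n₁ , n₃ , 1≤n₁ , 1≤n₃ , refl))))
  all-full⇒forms 1 (suc (suc (suc b))) 1 _ _ _ _ _ = x , y , x≢y , inj₂ (inj₁ (3 + b , s≤s z≤n , refl))
  all-full⇒forms 1 3 2 _ _ _ len _ = ⊥-elim (too-short _ len)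
  all-full⇒forms 1 4 2 _ _ _ len _ = ⊥-elim (too-short _ len)
  all-full⇒forms 1 3 (suc (suc (suc k))) _ _ _ _ _ =
    x , y , x≢y , inj₂ (inj₂ (inj₂ (inj₂ (inj₁ (3 , 3 + k , inj₁ refl , s≤s (s≤s (s≤s z≤n)) , refl)))))
  all-full⇒forms 1 4 (suc (suc (suc k))) _ _ _ _ _ =
    x , y , x≢y , inj₂ (inj₂ (inj₂ (inj₂ (inj₁ (4 , 3 + k , inj₂ refl , s≤s (s≤s (s≤s z≤n)) , refl)))))
  all-full⇒forms 1 (suc (suc (suc (suc (suc b))))) 2 _ _ _ _ all-full = ⊥-elim (xy⁵⁺x² b all-full)
  all-full⇒forms 1 (suc (suc (suc (suc (suc b))))) (suc (suc (suc k))) _ _ _ _ all-full =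
    ⊥-elim (xy⁵⁺x³⁺ b k all-full)
  all-full⇒forms 2 3 1 _ _ _ len _ = ⊥-elim (too-short _ len)
  all-full⇒forms 2 4 1 _ _ _ len _ = ⊥-elim (too-short _ len)
  all-full⇒forms (suc (suc (suc k))) 3 1 _ _ _ _ _ =
    x , y , x≢y , inj₂ (inj₂ (inj₂ (inj₂ (inj₂ (3 + k , 3 , inj₁ refl , s≤s (s≤s (s≤s z≤n)) , refl)))))
  all-full⇒forms (suc (suc (suc k))) 4 1 _ _ _ _ _ =
    x , y , x≢y , inj₂ (inj₂ (inj₂ (inj₂ (inj₂ (3 + k , 4 , inj₂ refl , s≤s (s≤s (s≤s z≤n)) , refl)))))
  all-full⇒forms 2 (suc (suc (suc (suc (suc b))))) 1 _ _ _ _ all-full =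
    ⊥-elim (xy⁵⁺x² b (AllFullBR-mirror x y 2 (5 + b) 1 all-full))
  all-full⇒forms (suc (suc (suc k))) (suc (suc (suc (suc (suc b))))) 1 _ _ _ _ all-full =
    ⊥-elim (xy⁵⁺x³⁺ b k (AllFullBR-mirror x y (3 + k) (5 + b) 1 all-full))
  all-full⇒forms (suc (suc (suc a))) (suc (suc (suc b))) (suc (suc k)) _ _ _ _ all-full =
    ⊥-elim (x³⁺y³⁺x²⁺ a b k all-full)
  all-full⇒forms 2 (suc (suc (suc b))) (suc (suc (suc k))) _ _ _ _ all-full =
    ⊥-elim (x³⁺y³⁺x²⁺ k b 0 (AllFullBR-mirror x y 2 (3 + b) (3 + k) all-full))
  all-full⇒forms 2 3 2 _ _ _ len _ = ⊥-elim (too-short _ len)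
  all-full⇒forms 2 4 2 _ _ _ _ _ = x , y , x≢y , inj₁ refl
  all-full⇒forms 2 (suc (suc (suc (suc (suc b))))) 2 _ _ _ _ all-full = ⊥-elim (x²y⁵⁺x² b all-full)

-- Words with three runs

expand : List (Letter × ℕ) → Word
expand []            = []
expand ((c , n) ∷ r) = c ^ n ++ expand r

expand-rle : ∀ w → expand (rle w) ≡ w
expand-rle []      = refl
expand-rle (a ∷ w) with rle w | expand-rle w
... | []          | e = cong (a ∷_) e
... | (c , n) ∷ r | e with a ≟ᵇ c
...   | yes refl = cong (a ∷_) e
...   | no _     = cong (a ∷_) e

Alternating : List (Letter × ℕ) → Set
Alternating []                        = ⊤
Alternating ((c , n) ∷ [])            = 1 ≤ n
Alternating ((c , n) ∷ (d , m) ∷ r) = 1 ≤ n × c ≢ d × Alternating ((d , m) ∷ r)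

rle-alternating : ∀ w → Alternating (rle w)
rle-alternating []      = tt
rle-alternating (a ∷ w) with rle w | rle-alternating w
... | []          | _ = s≤s z≤n
... | (c , n) ∷ r | alt with a ≟ᵇ c
...   | no a≢c   = s≤s z≤n , a≢c , alt
...   | yes refl with r | alt
...     | []    | _             = s≤s z≤n
...     | _ ∷ _ | (_ , c≢d , alt′) = s≤s z≤n , c≢d , alt′

three-runs : ∀ w → l w ≡ 3 → ∃[ x ] ∃[ y ] ∃[ n₁ ] ∃[ n₂ ] ∃[ n₃ ]
  (x ≢ y × 1 ≤ n₁ × 1 ≤ n₂ × 1 ≤ n₃ × w ≡ x ^ n₁ ++ y ^ n₂ ++ x ^ n₃)
three-runs w l≡3 with rle w | expand-rle w | rle-alternating w
... | (a , n₁) ∷ (b , n₂) ∷ (c , n₃) ∷ [] | e | (1≤n₁ , a≢b , 1≤n₂ , b≢c , 1≤n₃)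
  with x-or-y a≢b c
... | inj₂ refl = ⊥-elim (b≢c refl)
... | inj₁ refl = a , b , n₁ , n₂ , n₃ , a≢b , 1≤n₁ , 1≤n₂ , 1≤n₃ ,
  trans (sym e) (cong (λ z → a ^ n₁ ++ b ^ n₂ ++ z) (++-identityʳ (a ^ n₃)))

proposition4p20 : (w : Word) → Binary w → 7 < length w → l w ≡ 3 →
    ((∀ v → InBR w v → Rich v) ⇔ Forms w)
proposition4p20 w _ len l≡3 with three-runs w l≡3  -- Binary w already follows from l w ≡ 3
... | x , y , n₁ , n₂ , n₃ , x≢y , 1≤n₁ , 1≤n₂ , 1≤n₃ , refl = mk⇔
  (λ all-rich → Classification.all-full⇒forms x y x≢y n₁ n₂ n₃ 1≤n₁ 1≤n₂ 1≤n₃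
     (subst (7 <_) (length-x^y^x^ x y n₁ n₂ n₃) len) (λ v br → rich⇒full v (all-rich v br)))
  (λ forms v br → full⇒rich v (forms⇒AllFullBR _ forms v br))
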